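{- Let $G$ be a reflexive globular set. If $\tau:\ulcorner G\urcorner$ is a closed term derivable in $\mathbb{T}_0[G]$, then $\tau\simeq\ulcorner a\urcorner$ for some vertex $a\in G_0$, i.e. there is a derivable closed term of type $\mathrm{Id}_{\ulcorner G\urcorner}(\tau,\ulcorner a\urcorner)$.
   Context: $\mathbb{T}_0$ is intensional Martin-Löf type theory with dependent products, dependent sums (eliminator with conversion, no $\eta$), identity types with reflexivity $\mathrm{r}$ and eliminator $J$, and natural numbers, extended by the reflection rule (from $p:\mathrm{Id}_A(a,b)$ infer $a=b$ definitionally). For a reflexive globular set $G$ (sets $G_n$, $s,t:G_{n+1}\to G_n$, $i:G_n\to G_{n+1}$, globular and reflexivity identities), $\mathbb{T}_0[G]$ adds a basic type $\ulcorner G\urcorner$, basic closed terms $\ulcorner a\urcorner:\ulcorner G\urcorner$ for $a\in G_0$, basic closed terms $\ulcorner\alpha\urcorner$ in the appropriate iterated identity types for higher cells $\alpha$ (e.g. $\ulcorner f\urcorner:\mathrm{Id}_{\ulcorner G\urcorner}(\ulcorner s f\urcorner,\ulcorner t f\urcorner)$ for $f\in G_1$), and conversions $\ulcorner i(\alpha)\urcorner=\mathrm{r}(\ulcorner\alpha\urcorner)$. -}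

module Defs where

open import Data.Nat using (ℕ; zero; suc)
open import Relation.Binary.PropositionalEquality using (_≡_)

record RGS : Set₁ where
  field
    Cell : ℕ → Set
    src  : ∀ {n} → Cell (suc n) → Cell n
    tgt  : ∀ {n} → Cell (suc n) → Cell n
    idc  : ∀ {n} → Cell n → Cell (suc n)
    glob-s : ∀ {n} (x : Cell (suc (suc n))) → src (src x) ≡ src (tgt x)
    glob-t : ∀ {n} (x : Cell (suc (suc n))) → tgt (src x) ≡ tgt (tgt x)
    refl-s : ∀ {n} (x : Cell n) → src (idc x) ≡ x
    refl-t : ∀ {n} (x : Cell n) → tgt (idc x) ≡ x

-- The type theory T₀[G] (deep embedding, de Bruijn indices)

module Syntax (G : RGS) where
  open RGS G public

  -- raw expressions (types and terms share one grammar)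
  data Tm : Set where
    var    : ℕ → Tm
    `Π     : Tm → Tm → Tm                      -- Π A B,  B under 1 binder
    `Σ     : Tm → Tm → Tm                      -- Σ A B,  B under 1 binder
    `Id    : Tm → Tm → Tm → Tm
    `ℕ     : Tm
    `G     : Tm
    lam    : Tm → Tm → Tm                      -- lam A b, b under 1
    app    : Tm → Tm → Tm → Tm → Tm            -- app A B f a, B under 1
    pair   : Tm → Tm → Tm → Tm → Tm            -- pair A B a b, B under 1
    split  : Tm → Tm → Tm → Tm → Tm → Tm       -- split A B C d p; B,C under 1, d under 2
    rf     : Tm → Tm → Tm
    J      : Tm → Tm → Tm → Tm → Tm → Tm → Tm  -- J A C d a b p; C under 3, d under 1
    ze     : Tm
    su     : Tm → Tm
    natrec : Tm → Tm → Tm → Tm → Tm            -- natrec C z s n; C under 1, s under 2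
    cell   : (n : ℕ) → Cell n → Tm             -- ⌜α⌝ for α ∈ Gₙ (n = 0: vertices)

  liftR : (ℕ → ℕ) → ℕ → ℕ
  liftR ρ zero    = zero
  liftR ρ (suc k) = suc (ρ k)

  ren : (ℕ → ℕ) → Tm → Tm
  ren ρ (var k)            = var (ρ k)
  ren ρ (`Π A B)           = `Π (ren ρ A) (ren (liftR ρ) B)
  ren ρ (`Σ A B)           = `Σ (ren ρ A) (ren (liftR ρ) B)
  ren ρ (`Id A a b)        = `Id (ren ρ A) (ren ρ a) (ren ρ b)
  ren ρ `ℕ                 = `ℕ
  ren ρ `G                 = `G
  ren ρ (lam A b)          = lam (ren ρ A) (ren (liftR ρ) b)
  ren ρ (app A B f a)      = app (ren ρ A) (ren (liftR ρ) B) (ren ρ f) (ren ρ a)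
  ren ρ (pair A B a b)     = pair (ren ρ A) (ren (liftR ρ) B) (ren ρ a) (ren ρ b)
  ren ρ (split A B C d p)  = split (ren ρ A) (ren (liftR ρ) B) (ren (liftR ρ) C)
                                   (ren (liftR (liftR ρ)) d) (ren ρ p)
  ren ρ (rf A a)           = rf (ren ρ A) (ren ρ a)
  ren ρ (J A C d a b p)    = J (ren ρ A) (ren (liftR (liftR (liftR ρ))) C)
                               (ren (liftR ρ) d) (ren ρ a) (ren ρ b) (ren ρ p)
  ren ρ ze                 = ze
  ren ρ (su n)             = su (ren ρ n)
  ren ρ (natrec C z s n)   = natrec (ren (liftR ρ) C) (ren ρ z)
                                    (ren (liftR (liftR ρ)) s) (ren ρ n)
  ren ρ (cell n α)         = cell n α

  wk : Tm → Tm
  wk = ren suc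

  liftS : (ℕ → Tm) → ℕ → Tm
  liftS σ zero    = var zero
  liftS σ (suc k) = wk (σ k)

  sub : (ℕ → Tm) → Tm → Tm
  sub σ (var k)            = σ k
  sub σ (`Π A B)           = `Π (sub σ A) (sub (liftS σ) B)
  sub σ (`Σ A B)           = `Σ (sub σ A) (sub (liftS σ) B)
  sub σ (`Id A a b)        = `Id (sub σ A) (sub σ a) (sub σ b)
  sub σ `ℕ                 = `ℕ
  sub σ `G                 = `G
  sub σ (lam A b)          = lam (sub σ A) (sub (liftS σ) b)
  sub σ (app A B f a)      = app (sub σ A) (sub (liftS σ) B) (sub σ f) (sub σ a)
  sub σ (pair A B a b)     = pair (sub σ A) (sub (liftS σ) B) (sub σ a) (sub σ b)
  sub σ (split A B C d p)  = split (sub σ A) (sub (liftS σ) B) (sub (liftS σ) C)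
                                   (sub (liftS (liftS σ)) d) (sub σ p)
  sub σ (rf A a)           = rf (sub σ A) (sub σ a)
  sub σ (J A C d a b p)    = J (sub σ A) (sub (liftS (liftS (liftS σ))) C)
                               (sub (liftS σ) d) (sub σ a) (sub σ b) (sub σ p)
  sub σ ze                 = ze
  sub σ (su n)             = su (sub σ n)
  sub σ (natrec C z s n)   = natrec (sub (liftS σ) C) (sub σ z)
                                    (sub (liftS (liftS σ)) s) (sub σ n)
  sub σ (cell n α)         = cell n α

  ext : (ℕ → Tm) → Tm → ℕ → Tm
  ext σ a zero    = a
  ext σ a (suc k) = σ k

  _[_] : Tm → Tm → Tm
  B [ a ] = sub (ext var a) B

  _[_,_] : Tm → Tm → Tm → Tm        -- var 1 ↦ a, var 0 ↦ b
  B [ a , b ] = sub (ext (ext var a) b) B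

  _[_,_,_] : Tm → Tm → Tm → Tm → Tm  -- var 2 ↦ a, var 1 ↦ b, var 0 ↦ c
  B [ a , b , c ] = sub (ext (ext (ext var a) b) c) B

  -- type of the motive's instance for the Σ-eliminator:  Γ,x:A,y:B ⊢ C[pair x y]
  splitTy : Tm → Tm → Tm → Tm
  splitTy A B C =
    sub (ext (λ k → var (suc (suc k)))
             (pair (wk (wk A)) (ren (liftR (λ k → suc (suc k))) B) (var 1) (var 0))) C

  -- type of the J-premise:  Γ,x:A ⊢ C[x, x, r x]
  JreflTy : Tm → Tm → Tm
  JreflTy A C =
    sub (ext (ext (ext (λ k → var (suc k)) (var 0)) (var 0)) (rf (wk A) (var 0))) C

  -- type of the step for natrec:  Γ,n:ℕ,c:C ⊢ C[suc n]
  stepTy : Tm → Tm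
  stepTy C = sub (ext (λ k → var (suc (suc k))) (su (var 1))) C

  cellTy : (n : ℕ) → Cell n → Tm
  cellTy zero    a = `G
  cellTy (suc n) α = `Id (cellTy n (src α)) (cell n (src α)) (cell n (tgt α))

  data Ctx : Set where
    ε   : Ctx
    _▹_ : Ctx → Tm → Ctx

  infixl 5 _▹_

  data _∋_⦂_ : Ctx → ℕ → Tm → Set where
    here  : ∀ {Γ A} → (Γ ▹ A) ∋ zero ⦂ wk A
    there : ∀ {Γ A B k} → Γ ∋ k ⦂ A → (Γ ▹ B) ∋ suc k ⦂ wk A

  data ⊢_ : Ctx → Set
  data _⊢_type : Ctx → Tm → Set
  data _⊢_≐_type : Ctx → Tm → Tm → Set
  data _⊢_∶_ : Ctx → Tm → Tm → Set
  data _⊢_≐_∶_ : Ctx → Tm → Tm → Tm → Set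

  infix 4 ⊢_ _⊢_type _⊢_≐_type _⊢_∶_ _⊢_≐_∶_

  data ⊢_ where
    ε-wf : ⊢ ε
    ▹-wf : ∀ {Γ A} → Γ ⊢ A type → ⊢ Γ ▹ A

  data _⊢_type where
    ℕ-F  : ∀ {Γ} → ⊢ Γ → Γ ⊢ `ℕ type
    G-F  : ∀ {Γ} → ⊢ Γ → Γ ⊢ `G type
    Π-F  : ∀ {Γ A B} → Γ ⊢ A type → Γ ▹ A ⊢ B type → Γ ⊢ `Π A B type
    Σ-F  : ∀ {Γ A B} → Γ ⊢ A type → Γ ▹ A ⊢ B type → Γ ⊢ `Σ A B type
    Id-F : ∀ {Γ A a b} → Γ ⊢ A type → Γ ⊢ a ∶ A → Γ ⊢ b ∶ A → Γ ⊢ `Id A a b type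

  data _⊢_≐_type where
    ty-refl  : ∀ {Γ A} → Γ ⊢ A type → Γ ⊢ A ≐ A type
    ty-sym   : ∀ {Γ A B} → Γ ⊢ A ≐ B type → Γ ⊢ B ≐ A type
    ty-trans : ∀ {Γ A B C} → Γ ⊢ A ≐ B type → Γ ⊢ B ≐ C type → Γ ⊢ A ≐ C type
    Π-cong   : ∀ {Γ A A' B B'} → Γ ⊢ A type → Γ ⊢ A ≐ A' type → Γ ▹ A ⊢ B ≐ B' type
             → Γ ⊢ `Π A B ≐ `Π A' B' type
    Σ-cong   : ∀ {Γ A A' B B'} → Γ ⊢ A type → Γ ⊢ A ≐ A' type → Γ ▹ A ⊢ B ≐ B' type
             → Γ ⊢ `Σ A B ≐ `Σ A' B' type
    Id-cong  : ∀ {Γ A A' a a' b b'} → Γ ⊢ A ≐ A' type → Γ ⊢ a ≐ a' ∶ A → Γ ⊢ b ≐ b' ∶ A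
             → Γ ⊢ `Id A a b ≐ `Id A' a' b' type

  data _⊢_∶_ where
    var-I  : ∀ {Γ k A} → ⊢ Γ → Γ ∋ k ⦂ A → Γ ⊢ var k ∶ A
    conv   : ∀ {Γ a A B} → Γ ⊢ a ∶ A → Γ ⊢ A ≐ B type → Γ ⊢ a ∶ B
    Π-I    : ∀ {Γ A B b} → Γ ⊢ A type → Γ ▹ A ⊢ b ∶ B → Γ ⊢ lam A b ∶ `Π A B
    Π-E    : ∀ {Γ A B f a} → Γ ▹ A ⊢ B type → Γ ⊢ f ∶ `Π A B → Γ ⊢ a ∶ A
           → Γ ⊢ app A B f a ∶ B [ a ]
    Σ-I    : ∀ {Γ A B a b} → Γ ▹ A ⊢ B type → Γ ⊢ a ∶ A → Γ ⊢ b ∶ B [ a ]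
           → Γ ⊢ pair A B a b ∶ `Σ A B
    Σ-E    : ∀ {Γ A B C d p} → Γ ▹ `Σ A B ⊢ C type → Γ ▹ A ▹ B ⊢ d ∶ splitTy A B C
           → Γ ⊢ p ∶ `Σ A B → Γ ⊢ split A B C d p ∶ C [ p ]
    Id-I   : ∀ {Γ A a} → Γ ⊢ a ∶ A → Γ ⊢ rf A a ∶ `Id A a a
    Id-E   : ∀ {Γ A C d a b p} → Γ ⊢ A type
           → Γ ▹ A ▹ wk A ▹ `Id (wk (wk A)) (var 1) (var 0) ⊢ C type
           → Γ ▹ A ⊢ d ∶ JreflTy A C
           → Γ ⊢ p ∶ `Id A a b → Γ ⊢ J A C d a b p ∶ C [ a , b , p ]
    ℕ-I₀   : ∀ {Γ} → ⊢ Γ → Γ ⊢ ze ∶ `ℕ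
    ℕ-I₁   : ∀ {Γ n} → Γ ⊢ n ∶ `ℕ → Γ ⊢ su n ∶ `ℕ
    ℕ-E    : ∀ {Γ C z s n} → Γ ▹ `ℕ ⊢ C type → Γ ⊢ z ∶ C [ ze ]
           → Γ ▹ `ℕ ▹ C ⊢ s ∶ stepTy C → Γ ⊢ n ∶ `ℕ → Γ ⊢ natrec C z s n ∶ C [ n ]
    cell-I : ∀ {Γ} n (α : Cell n) → ⊢ Γ → Γ ⊢ cell n α ∶ cellTy n α

  data _⊢_≐_∶_ where
    tm-refl  : ∀ {Γ a A} → Γ ⊢ a ∶ A → Γ ⊢ a ≐ a ∶ A
    tm-sym   : ∀ {Γ a b A} → Γ ⊢ a ≐ b ∶ A → Γ ⊢ b ≐ a ∶ A
    tm-trans : ∀ {Γ a b c A} → Γ ⊢ a ≐ b ∶ A → Γ ⊢ b ≐ c ∶ A → Γ ⊢ a ≐ c ∶ A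
    tm-conv  : ∀ {Γ a b A B} → Γ ⊢ a ≐ b ∶ A → Γ ⊢ A ≐ B type → Γ ⊢ a ≐ b ∶ B
    reflect  : ∀ {Γ A a b p} → Γ ⊢ p ∶ `Id A a b → Γ ⊢ a ≐ b ∶ A
    Π-β      : ∀ {Γ A B b a} → Γ ⊢ A type → Γ ▹ A ⊢ b ∶ B → Γ ⊢ a ∶ A
             → Γ ⊢ app A B (lam A b) a ≐ b [ a ] ∶ B [ a ]
    Σ-β      : ∀ {Γ A B C d a b} → Γ ▹ `Σ A B ⊢ C type
             → Γ ▹ A ▹ B ⊢ d ∶ splitTy A B C
             → Γ ▹ A ⊢ B type → Γ ⊢ a ∶ A → Γ ⊢ b ∶ B [ a ]
             → Γ ⊢ split A B C d (pair A B a b) ≐ d [ a , b ] ∶ C [ pair A B a b ]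
    Id-β     : ∀ {Γ A C d a} → Γ ⊢ A type
             → Γ ▹ A ▹ wk A ▹ `Id (wk (wk A)) (var 1) (var 0) ⊢ C type
             → Γ ▹ A ⊢ d ∶ JreflTy A C → Γ ⊢ a ∶ A
             → Γ ⊢ J A C d a a (rf A a) ≐ d [ a ] ∶ C [ a , a , rf A a ]
    ℕ-β₀     : ∀ {Γ C z s} → Γ ▹ `ℕ ⊢ C type → Γ ⊢ z ∶ C [ ze ]
             → Γ ▹ `ℕ ▹ C ⊢ s ∶ stepTy C
             → Γ ⊢ natrec C z s ze ≐ z ∶ C [ ze ]
    ℕ-β₁     : ∀ {Γ C z s n} → Γ ▹ `ℕ ⊢ C type → Γ ⊢ z ∶ C [ ze ]
             → Γ ▹ `ℕ ▹ C ⊢ s ∶ stepTy C → Γ ⊢ n ∶ `ℕ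
             → Γ ⊢ natrec C z s (su n) ≐ s [ n , natrec C z s n ] ∶ C [ su n ]
    lam-cong : ∀ {Γ A A' B b b'} → Γ ⊢ A type → Γ ⊢ A ≐ A' type → Γ ▹ A ⊢ b ≐ b' ∶ B
             → Γ ⊢ lam A b ≐ lam A' b' ∶ `Π A B
    app-cong : ∀ {Γ A A' B B' f f' a a'} → Γ ⊢ A ≐ A' type → Γ ▹ A ⊢ B ≐ B' type
             → Γ ⊢ f ≐ f' ∶ `Π A B → Γ ⊢ a ≐ a' ∶ A
             → Γ ⊢ app A B f a ≐ app A' B' f' a' ∶ B [ a ]
    pair-cong : ∀ {Γ A A' B B' a a' b b'} → Γ ⊢ A ≐ A' type → Γ ▹ A ⊢ B ≐ B' type
             → Γ ⊢ a ≐ a' ∶ A → Γ ⊢ b ≐ b' ∶ B [ a ]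
             → Γ ⊢ pair A B a b ≐ pair A' B' a' b' ∶ `Σ A B
    split-cong : ∀ {Γ A A' B B' C C' d d' p p'} → Γ ⊢ A ≐ A' type → Γ ▹ A ⊢ B ≐ B' type
             → Γ ▹ `Σ A B ⊢ C ≐ C' type → Γ ▹ A ▹ B ⊢ d ≐ d' ∶ splitTy A B C
             → Γ ⊢ p ≐ p' ∶ `Σ A B
             → Γ ⊢ split A B C d p ≐ split A' B' C' d' p' ∶ C [ p ]
    rf-cong  : ∀ {Γ A A' a a'} → Γ ⊢ A ≐ A' type → Γ ⊢ a ≐ a' ∶ A
             → Γ ⊢ rf A a ≐ rf A' a' ∶ `Id A a a
    J-cong   : ∀ {Γ A A' C C' d d' a a' b b' p p'} → Γ ⊢ A ≐ A' type
             → Γ ▹ A ▹ wk A ▹ `Id (wk (wk A)) (var 1) (var 0) ⊢ C ≐ C' type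
             → Γ ▹ A ⊢ d ≐ d' ∶ JreflTy A C
             → Γ ⊢ a ≐ a' ∶ A → Γ ⊢ b ≐ b' ∶ A → Γ ⊢ p ≐ p' ∶ `Id A a b
             → Γ ⊢ J A C d a b p ≐ J A' C' d' a' b' p' ∶ C [ a , b , p ]
    su-cong  : ∀ {Γ n n'} → Γ ⊢ n ≐ n' ∶ `ℕ → Γ ⊢ su n ≐ su n' ∶ `ℕ
    natrec-cong : ∀ {Γ C C' z z' s s' n n'} → Γ ▹ `ℕ ⊢ C ≐ C' type
             → Γ ⊢ z ≐ z' ∶ C [ ze ] → Γ ▹ `ℕ ▹ C ⊢ s ≐ s' ∶ stepTy C
             → Γ ⊢ n ≐ n' ∶ `ℕ
             → Γ ⊢ natrec C z s n ≐ natrec C' z' s' n' ∶ C [ n ]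
    cell-idc : ∀ {Γ} n (α : Cell n) → ⊢ Γ
             → Γ ⊢ cell (suc n) (idc α) ≐ rf (cellTy n α) (cell n α) ∶ cellTy (suc n) (idc α)

-- Canonicity by a reducibility (logical) relation on closed terms. A closed term is
-- reducible at a type when it is judgmentally equal to a canonical form with reducible
-- components: a vertex ⌜a⌝ at ⌜G⌝, a numeral at ℕ, a pair at Σ, a function sending
-- reducible arguments to reducible results at Π, and, at Id A a b, nothing but a
-- reducible point u ≐ a. The last clause suffices because the reflection rule makes
-- every proof p of Id A a b satisfy a ≐ b and (via J) p ≐ r(a), so J always computes.
-- The fundamental lemma makes every derivable term reducible under a reducible closing
-- substitution; for τ : ⌜G⌝ and the empty substitution it gives τ ≐ ⌜a⌝, and r(τ) is
-- then a proof of Id(τ, ⌜a⌝).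
module Submission where

open import Defs
open import Data.Product using (Σ-syntax; Σ; _×_; _,_; proj₁; proj₂)
open import Data.Nat using (ℕ; zero; suc)
open import Data.Empty using (⊥)
open import Relation.Binary.PropositionalEquality
  using (_≡_; refl; sym; trans; cong; cong₂; subst)

cong₃ : ∀ {A B C D : Set} (f : A → B → C → D) {a a' b b' c c'} → a ≡ a' → b ≡ b' → c ≡ c' → f a b c ≡ f a' b' c'
cong₃ f refl refl refl = refl
cong₄ : ∀ {A B C D E : Set} (f : A → B → C → D → E) {a a' b b' c c' d d'} → a ≡ a' → b ≡ b' → c ≡ c' → d ≡ d' → f a b c d ≡ f a' b' c' d'
cong₄ f refl refl refl refl = refl
cong₅ : ∀ {A B C D E F : Set} (f : A → B → C → D → E → F) {a a' b b' c c' d d' e e'} → a ≡ a' → b ≡ b' → c ≡ c' → d ≡ d' → e ≡ e' → f a b c d e ≡ f a' b' c' d' e'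
cong₅ f refl refl refl refl refl = refl
cong₆ : ∀ {A B C D E F H : Set} (f : A → B → C → D → E → F → H) {a a' b b' c c' d d' e e' g g'} → a ≡ a' → b ≡ b' → c ≡ c' → d ≡ d' → e ≡ e' → g ≡ g' → f a b c d e g ≡ f a' b' c' d' e' g'
cong₆ f refl refl refl refl refl refl = refl

module Metatheory (G : RGS) where
  open Syntax G public

  -- Renaming and substitution of raw expressions

  Sub : Set
  Sub = ℕ → Tm
  Ren : Set
  Ren = ℕ → ℕ

  rr-lift : ∀ {ρ ρ' θ : Ren} → (∀ k → ρ (ρ' k) ≡ θ k) → ∀ k → liftR ρ (liftR ρ' k) ≡ liftR θ k
  rr-lift e zero = refl
  rr-lift e (suc k) = cong suc (e k)

  ren-ren : ∀ {ρ ρ' θ : Ren} → (∀ k → ρ (ρ' k) ≡ θ k) → ∀ t → ren ρ (ren ρ' t) ≡ ren θ t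
  ren-ren e (var k) = cong var (e k)
  ren-ren e (`Π A B) = cong₂ `Π (ren-ren e A) (ren-ren (rr-lift e) B)
  ren-ren e (`Σ A B) = cong₂ `Σ (ren-ren e A) (ren-ren (rr-lift e) B)
  ren-ren e (`Id A B C) = cong₃ `Id (ren-ren e A) (ren-ren e B) (ren-ren e C)
  ren-ren e `ℕ = refl
  ren-ren e `G = refl
  ren-ren e (lam A B) = cong₂ lam (ren-ren e A) (ren-ren (rr-lift e) B)
  ren-ren e (app A B C D) = cong₄ app (ren-ren e A) (ren-ren (rr-lift e) B) (ren-ren e C) (ren-ren e D)
  ren-ren e (pair A B C D) = cong₄ pair (ren-ren e A) (ren-ren (rr-lift e) B) (ren-ren e C) (ren-ren e D)
  ren-ren e (split A B C D E) = cong₅ split (ren-ren e A) (ren-ren (rr-lift e) B) (ren-ren (rr-lift e) C) (ren-ren (rr-lift (rr-lift e)) D) (ren-ren e E)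
  ren-ren e (rf A B) = cong₂ rf (ren-ren e A) (ren-ren e B)
  ren-ren e (J A B C D E F) = cong₆ J (ren-ren e A) (ren-ren (rr-lift (rr-lift (rr-lift e))) B) (ren-ren (rr-lift e) C) (ren-ren e D) (ren-ren e E) (ren-ren e F)
  ren-ren e ze = refl
  ren-ren e (su A) = cong su (ren-ren e A)
  ren-ren e (natrec A B C D) = cong₄ natrec (ren-ren (rr-lift e) A) (ren-ren e B) (ren-ren (rr-lift (rr-lift e)) C) (ren-ren e D)
  ren-ren e (cell n α) = refl

  rs-lift : ∀ {ρ : Ren} {σ θ : Sub} → (∀ k → ren ρ (σ k) ≡ θ k) → ∀ k → ren (liftR ρ) (liftS σ k) ≡ liftS θ k
  rs-lift e zero = refl
  rs-lift {ρ} {σ} e (suc k) = trans (ren-ren {θ = λ j → suc (ρ j)} (λ _ → refl) (σ k))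
     (trans (sym (ren-ren {θ = λ j → suc (ρ j)} (λ _ → refl) (σ k))) (cong wk (e k)))

  ren-sub : ∀ {ρ : Ren} {σ θ : Sub} → (∀ k → ren ρ (σ k) ≡ θ k) → ∀ t → ren ρ (sub σ t) ≡ sub θ t
  ren-sub e (var k) = e k
  ren-sub e (`Π A B) = cong₂ `Π (ren-sub e A) (ren-sub (rs-lift e) B)
  ren-sub e (`Σ A B) = cong₂ `Σ (ren-sub e A) (ren-sub (rs-lift e) B)
  ren-sub e (`Id A B C) = cong₃ `Id (ren-sub e A) (ren-sub e B) (ren-sub e C)
  ren-sub e `ℕ = refl
  ren-sub e `G = refl
  ren-sub e (lam A B) = cong₂ lam (ren-sub e A) (ren-sub (rs-lift e) B)
  ren-sub e (app A B C D) = cong₄ app (ren-sub e A) (ren-sub (rs-lift e) B) (ren-sub e C) (ren-sub e D)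
  ren-sub e (pair A B C D) = cong₄ pair (ren-sub e A) (ren-sub (rs-lift e) B) (ren-sub e C) (ren-sub e D)
  ren-sub e (split A B C D E) = cong₅ split (ren-sub e A) (ren-sub (rs-lift e) B) (ren-sub (rs-lift e) C) (ren-sub (rs-lift (rs-lift e)) D) (ren-sub e E)
  ren-sub e (rf A B) = cong₂ rf (ren-sub e A) (ren-sub e B)
  ren-sub e (J A B C D E F) = cong₆ J (ren-sub e A) (ren-sub (rs-lift (rs-lift (rs-lift e))) B) (ren-sub (rs-lift e) C) (ren-sub e D) (ren-sub e E) (ren-sub e F)
  ren-sub e ze = refl
  ren-sub e (su A) = cong su (ren-sub e A)
  ren-sub e (natrec A B C D) = cong₄ natrec (ren-sub (rs-lift e) A) (ren-sub e B) (ren-sub (rs-lift (rs-lift e)) C) (ren-sub e D)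
  ren-sub e (cell n α) = refl

  sr-lift : ∀ {σ : Sub} {ρ : Ren} {θ : Sub} → (∀ k → σ (ρ k) ≡ θ k) → ∀ k → liftS σ (liftR ρ k) ≡ liftS θ k
  sr-lift e zero = refl
  sr-lift e (suc k) = cong wk (e k)

  sub-ren : ∀ {σ : Sub} {ρ : Ren} {θ : Sub} → (∀ k → σ (ρ k) ≡ θ k) → ∀ t → sub σ (ren ρ t) ≡ sub θ t
  sub-ren e (var k) = e k
  sub-ren e (`Π A B) = cong₂ `Π (sub-ren e A) (sub-ren (sr-lift e) B)
  sub-ren e (`Σ A B) = cong₂ `Σ (sub-ren e A) (sub-ren (sr-lift e) B)
  sub-ren e (`Id A B C) = cong₃ `Id (sub-ren e A) (sub-ren e B) (sub-ren e C)
  sub-ren e `ℕ = refl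
  sub-ren e `G = refl
  sub-ren e (lam A B) = cong₂ lam (sub-ren e A) (sub-ren (sr-lift e) B)
  sub-ren e (app A B C D) = cong₄ app (sub-ren e A) (sub-ren (sr-lift e) B) (sub-ren e C) (sub-ren e D)
  sub-ren e (pair A B C D) = cong₄ pair (sub-ren e A) (sub-ren (sr-lift e) B) (sub-ren e C) (sub-ren e D)
  sub-ren e (split A B C D E) = cong₅ split (sub-ren e A) (sub-ren (sr-lift e) B) (sub-ren (sr-lift e) C) (sub-ren (sr-lift (sr-lift e)) D) (sub-ren e E)
  sub-ren e (rf A B) = cong₂ rf (sub-ren e A) (sub-ren e B)
  sub-ren e (J A B C D E F) = cong₆ J (sub-ren e A) (sub-ren (sr-lift (sr-lift (sr-lift e))) B) (sub-ren (sr-lift e) C) (sub-ren e D) (sub-ren e E) (sub-ren e F)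
  sub-ren e ze = refl
  sub-ren e (su A) = cong su (sub-ren e A)
  sub-ren e (natrec A B C D) = cong₄ natrec (sub-ren (sr-lift e) A) (sub-ren e B) (sub-ren (sr-lift (sr-lift e)) C) (sub-ren e D)
  sub-ren e (cell n α) = refl

  ss-lift : ∀ {σ τ θ : Sub} → (∀ k → sub σ (τ k) ≡ θ k) → ∀ k → sub (liftS σ) (liftS τ k) ≡ liftS θ k
  ss-lift e zero = refl
  ss-lift {σ} {τ} e (suc k) = trans (sub-ren {θ = λ j → wk (σ j)} (λ _ → refl) (τ k))
     (trans (sym (ren-sub {θ = λ j → wk (σ j)} (λ _ → refl) (τ k))) (cong wk (e k)))

  sub-sub : ∀ {σ τ θ : Sub} → (∀ k → sub σ (τ k) ≡ θ k) → ∀ t → sub σ (sub τ t) ≡ sub θ t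
  sub-sub e (var k) = e k
  sub-sub e (`Π A B) = cong₂ `Π (sub-sub e A) (sub-sub (ss-lift e) B)
  sub-sub e (`Σ A B) = cong₂ `Σ (sub-sub e A) (sub-sub (ss-lift e) B)
  sub-sub e (`Id A B C) = cong₃ `Id (sub-sub e A) (sub-sub e B) (sub-sub e C)
  sub-sub e `ℕ = refl
  sub-sub e `G = refl
  sub-sub e (lam A B) = cong₂ lam (sub-sub e A) (sub-sub (ss-lift e) B)
  sub-sub e (app A B C D) = cong₄ app (sub-sub e A) (sub-sub (ss-lift e) B) (sub-sub e C) (sub-sub e D)
  sub-sub e (pair A B C D) = cong₄ pair (sub-sub e A) (sub-sub (ss-lift e) B) (sub-sub e C) (sub-sub e D)
  sub-sub e (split A B C D E) = cong₅ split (sub-sub e A) (sub-sub (ss-lift e) B) (sub-sub (ss-lift e) C) (sub-sub (ss-lift (ss-lift e)) D) (sub-sub e E)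
  sub-sub e (rf A B) = cong₂ rf (sub-sub e A) (sub-sub e B)
  sub-sub e (J A B C D E F) = cong₆ J (sub-sub e A) (sub-sub (ss-lift (ss-lift (ss-lift e))) B) (sub-sub (ss-lift e) C) (sub-sub e D) (sub-sub e E) (sub-sub e F)
  sub-sub e ze = refl
  sub-sub e (su A) = cong su (sub-sub e A)
  sub-sub e (natrec A B C D) = cong₄ natrec (sub-sub (ss-lift e) A) (sub-sub e B) (sub-sub (ss-lift (ss-lift e)) C) (sub-sub e D)
  sub-sub e (cell n α) = refl

  si-lift : ∀ {σ : Sub} → (∀ k → σ k ≡ var k) → ∀ k → liftS σ k ≡ var k
  si-lift e zero = refl
  si-lift e (suc k) = cong wk (e k)

  sub-id : ∀ {σ : Sub} → (∀ k → σ k ≡ var k) → ∀ t → sub σ t ≡ t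
  sub-id e (var k) = e k
  sub-id e (`Π A B) = cong₂ `Π (sub-id e A) (sub-id (si-lift e) B)
  sub-id e (`Σ A B) = cong₂ `Σ (sub-id e A) (sub-id (si-lift e) B)
  sub-id e (`Id A B C) = cong₃ `Id (sub-id e A) (sub-id e B) (sub-id e C)
  sub-id e `ℕ = refl
  sub-id e `G = refl
  sub-id e (lam A B) = cong₂ lam (sub-id e A) (sub-id (si-lift e) B)
  sub-id e (app A B C D) = cong₄ app (sub-id e A) (sub-id (si-lift e) B) (sub-id e C) (sub-id e D)
  sub-id e (pair A B C D) = cong₄ pair (sub-id e A) (sub-id (si-lift e) B) (sub-id e C) (sub-id e D)
  sub-id e (split A B C D E) = cong₅ split (sub-id e A) (sub-id (si-lift e) B) (sub-id (si-lift e) C) (sub-id (si-lift (si-lift e)) D) (sub-id e E)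
  sub-id e (rf A B) = cong₂ rf (sub-id e A) (sub-id e B)
  sub-id e (J A B C D E F) = cong₆ J (sub-id e A) (sub-id (si-lift (si-lift (si-lift e))) B) (sub-id (si-lift e) C) (sub-id e D) (sub-id e E) (sub-id e F)
  sub-id e ze = refl
  sub-id e (su A) = cong su (sub-id e A)
  sub-id e (natrec A B C D) = cong₄ natrec (sub-id (si-lift e) A) (sub-id e B) (sub-id (si-lift (si-lift e)) C) (sub-id e D)
  sub-id e (cell n α) = refl

  ras-lift : ∀ {ρ : Ren} {σ : Sub} → (∀ k → var (ρ k) ≡ σ k) → ∀ k → var (liftR ρ k) ≡ liftS σ k
  ras-lift e zero = refl
  ras-lift e (suc k) = cong wk (e k)

  ren-as-sub : ∀ {ρ : Ren} {σ : Sub} → (∀ k → var (ρ k) ≡ σ k) → ∀ t → ren ρ t ≡ sub σ t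
  ren-as-sub e (var k) = e k
  ren-as-sub e (`Π A B) = cong₂ `Π (ren-as-sub e A) (ren-as-sub (ras-lift e) B)
  ren-as-sub e (`Σ A B) = cong₂ `Σ (ren-as-sub e A) (ren-as-sub (ras-lift e) B)
  ren-as-sub e (`Id A B C) = cong₃ `Id (ren-as-sub e A) (ren-as-sub e B) (ren-as-sub e C)
  ren-as-sub e `ℕ = refl
  ren-as-sub e `G = refl
  ren-as-sub e (lam A B) = cong₂ lam (ren-as-sub e A) (ren-as-sub (ras-lift e) B)
  ren-as-sub e (app A B C D) = cong₄ app (ren-as-sub e A) (ren-as-sub (ras-lift e) B) (ren-as-sub e C) (ren-as-sub e D)
  ren-as-sub e (pair A B C D) = cong₄ pair (ren-as-sub e A) (ren-as-sub (ras-lift e) B) (ren-as-sub e C) (ren-as-sub e D)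
  ren-as-sub e (split A B C D E) = cong₅ split (ren-as-sub e A) (ren-as-sub (ras-lift e) B) (ren-as-sub (ras-lift e) C) (ren-as-sub (ras-lift (ras-lift e)) D) (ren-as-sub e E)
  ren-as-sub e (rf A B) = cong₂ rf (ren-as-sub e A) (ren-as-sub e B)
  ren-as-sub e (J A B C D E F) = cong₆ J (ren-as-sub e A) (ren-as-sub (ras-lift (ras-lift (ras-lift e))) B) (ren-as-sub (ras-lift e) C) (ren-as-sub e D) (ren-as-sub e E) (ren-as-sub e F)
  ren-as-sub e ze = refl
  ren-as-sub e (su A) = cong su (ren-as-sub e A)
  ren-as-sub e (natrec A B C D) = cong₄ natrec (ren-as-sub (ras-lift e) A) (ren-as-sub e B) (ren-as-sub (ras-lift (ras-lift e)) C) (ren-as-sub e D)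
  ren-as-sub e (cell n α) = refl

  trans-sym : ∀ {A : Set} {x y z : A} → x ≡ y → z ≡ y → x ≡ z
  trans-sym p q = trans p (sym q)

  sub-wk : ∀ (τ : Sub) x → sub τ (wk x) ≡ sub (λ k → τ (suc k)) x
  sub-wk τ x = sub-ren (λ _ → refl) x

  wk-as-sub : ∀ x → wk x ≡ sub (λ k → var (suc k)) x
  wk-as-sub x = ren-as-sub (λ _ → refl) x

  wk-sub : ∀ (σ : Sub) t → sub (liftS σ) (wk t) ≡ wk (sub σ t)
  wk-sub σ t = trans-sym (sub-ren (λ _ → refl) t) (ren-sub (λ _ → refl) t)

  sub-ext-wk : ∀ (σ : Sub) u t → sub (ext σ u) (wk t) ≡ sub σ t
  sub-ext-wk σ u t = sub-ren (λ _ → refl) t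

  sub-var : ∀ t → sub var t ≡ t
  sub-var t = sub-id (λ _ → refl) t

  wk²-as-sub : ∀ x → wk (wk x) ≡ sub (λ k → var (suc (suc k))) x
  wk²-as-sub x = trans (ren-ren (λ _ → refl) x) (ren-as-sub (λ _ → refl) x)

  ext-var : ∀ (σ : Sub) a → ∀ k → sub σ (ext var a k) ≡ ext σ (sub σ a) k
  ext-var σ a zero = refl
  ext-var σ a (suc k) = refl

  ext²-var : ∀ (σ : Sub) a b → ∀ k → sub σ (ext (ext var a) b k) ≡ ext (ext σ (sub σ a)) (sub σ b) k
  ext²-var σ a b zero = refl
  ext²-var σ a b (suc zero) = refl
  ext²-var σ a b (suc (suc k)) = refl

  ext³-var : ∀ (σ : Sub) a b c → ∀ k → sub σ (ext (ext (ext var a) b) c k) ≡ ext (ext (ext σ (sub σ a)) (sub σ b)) (sub σ c) k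
  ext³-var σ a b c zero = refl
  ext³-var σ a b c (suc zero) = refl
  ext³-var σ a b c (suc (suc zero)) = refl
  ext³-var σ a b c (suc (suc (suc k))) = refl

  lift-ext : ∀ (σ : Sub) a B → sub (ext var a) (sub (liftS σ) B) ≡ sub (ext σ a) B
  lift-ext σ a B = sub-sub h B
    where h : ∀ k → sub (ext var a) (liftS σ k) ≡ ext σ a k
          h zero = refl
          h (suc k) = trans (sub-ext-wk var a (σ k)) (sub-var (σ k))

  sub-single : ∀ (σ : Sub) a B → sub σ (B [ a ]) ≡ sub (ext σ (sub σ a)) B
  sub-single σ a B = sub-sub (ext-var σ a) B

  sub-[] : ∀ (σ : Sub) a B → sub σ (B [ a ]) ≡ (sub (liftS σ) B) [ sub σ a ]
  sub-[] σ a B = trans-sym (sub-single σ a B) (lift-ext σ (sub σ a) B)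

  lift2-ext : ∀ (σ : Sub) a b B → sub (ext (ext var a) b) (sub (liftS (liftS σ)) B) ≡ sub (ext (ext σ a) b) B
  lift2-ext σ a b B = sub-sub h B
    where h : ∀ k → sub (ext (ext var a) b) (liftS (liftS σ) k) ≡ ext (ext σ a) b k
          h zero = refl
          h (suc zero) = refl
          h (suc (suc k)) = trans (sub-wk _ (wk (σ k))) (trans (sub-wk _ (σ k)) (sub-var (σ k)))

  sub-double : ∀ (σ : Sub) a b B → sub σ (_[_,_] B a b) ≡ sub (ext (ext σ (sub σ a)) (sub σ b)) B
  sub-double σ a b B = sub-sub (ext²-var σ a b) B

  sub-[,] : ∀ (σ : Sub) a b B → sub σ (_[_,_] B a b) ≡ _[_,_] (sub (liftS (liftS σ)) B) (sub σ a) (sub σ b)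
  sub-[,] σ a b B = trans-sym (sub-double σ a b B) (lift2-ext σ (sub σ a) (sub σ b) B)

  lift3-ext : ∀ (σ : Sub) a b c B → sub (ext (ext (ext var a) b) c) (sub (liftS (liftS (liftS σ))) B) ≡ sub (ext (ext (ext σ a) b) c) B
  lift3-ext σ a b c B = sub-sub h B
    where h : ∀ k → sub (ext (ext (ext var a) b) c) (liftS (liftS (liftS σ)) k) ≡ ext (ext (ext σ a) b) c k
          h zero = refl
          h (suc zero) = refl
          h (suc (suc zero)) = refl
          h (suc (suc (suc k))) = trans (sub-wk _ (wk (wk (σ k)))) (trans (sub-wk _ (wk (σ k))) (trans (sub-wk _ (σ k)) (sub-var (σ k))))

  sub-triple : ∀ (σ : Sub) a b c B → sub σ (_[_,_,_] B a b c) ≡ sub (ext (ext (ext σ (sub σ a)) (sub σ b)) (sub σ c)) B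
  sub-triple σ a b c B = sub-sub (ext³-var σ a b c) B

  sub-[,,] : ∀ (σ : Sub) a b c B → sub σ (_[_,_,_] B a b c) ≡ _[_,_,_] (sub (liftS (liftS (liftS σ))) B) (sub σ a) (sub σ b) (sub σ c)
  sub-[,,] σ a b c B = trans-sym (sub-triple σ a b c B) (lift3-ext σ (sub σ a) (sub σ b) (sub σ c) B)

  wk²-sub : ∀ (σ : Sub) t → sub (liftS (liftS σ)) (wk (wk t)) ≡ wk (wk (sub σ t))
  wk²-sub σ t = trans (wk-sub (liftS σ) (wk t)) (cong wk (wk-sub σ t))

  wk²-ext² : ∀ (σ : Sub) u v A → sub (ext (ext σ u) v) (wk (wk A)) ≡ sub σ A
  wk²-ext² σ u v A = trans (sub-wk _ (wk A)) (sub-wk _ A)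

  sub-liftS-var : ∀ t → sub (liftS var) t ≡ t
  sub-liftS-var t = sub-id (si-lift (λ _ → refl)) t

  sub-liftS²-var : ∀ t → sub (liftS (liftS var)) t ≡ t
  sub-liftS²-var t = sub-id (si-lift (si-lift (λ _ → refl))) t

  sub-liftS³-var : ∀ t → sub (liftS (liftS (liftS var))) t ≡ t
  sub-liftS³-var t = sub-id (si-lift (si-lift (si-lift (λ _ → refl)))) t

  wk³-ext³ : ∀ (σ : Sub) u v p A → sub (ext (ext (ext σ u) v) p) (wk (wk (wk A))) ≡ sub σ A
  wk³-ext³ σ u v p A = trans (sub-wk _ (wk (wk A))) (trans (sub-wk _ (wk A)) (sub-wk _ A))

  sub-splitTy : ∀ (σ : Sub) A B C → sub (liftS (liftS σ)) (splitTy A B C) ≡ splitTy (sub σ A) (sub (liftS σ) B) (sub (liftS σ) C)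
  sub-splitTy σ A B C = trans-sym (sub-sub h1 C) (sub-sub h2 C)
    where
      τ' : Sub
      τ' = ext (λ k → var (suc (suc k))) (pair (wk (wk (sub σ A))) (ren (liftR (λ k → suc (suc k))) (sub (liftS σ) B)) (var 1) (var 0))
      θ : Sub
      θ = ext (λ k → wk (wk (σ k))) (pair (wk (wk (sub σ A))) (ren (liftR (λ k → suc (suc k))) (sub (liftS σ) B)) (var 1) (var 0))
      eB : sub (liftS (liftS (liftS σ))) (ren (liftR (λ k → suc (suc k))) B) ≡ ren (liftR (λ k → suc (suc k))) (sub (liftS σ) B)
      eB = trans-sym (sub-ren hh B) (ren-sub hh' B)
        where
          θ3 : Sub
          θ3 = ext (λ k → wk (wk (wk (σ k)))) (var 0)
          hh : ∀ k → liftS (liftS (liftS σ)) (liftR (λ k → suc (suc k)) k) ≡ θ3 k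
          hh zero = refl
          hh (suc k) = refl
          hh' : ∀ k → ren (liftR (λ k → suc (suc k))) (liftS σ k) ≡ θ3 k
          hh' zero = refl
          hh' (suc k) = trans-sym (ren-ren {θ = λ j → suc (suc (suc j))} (λ _ → refl) (σ k)) (trans (cong wk (ren-ren {θ = λ j → suc (suc j)} (λ _ → refl) (σ k))) (ren-ren {θ = λ j → suc (suc (suc j))} (λ _ → refl) (σ k)))
      h1 : ∀ k → sub (liftS (liftS σ)) (ext (λ k → var (suc (suc k))) (pair (wk (wk A)) (ren (liftR (λ k → suc (suc k))) B) (var 1) (var 0)) k) ≡ θ k
      h1 zero = cong₄ pair (wk²-sub σ A) eB refl refl
      h1 (suc k) = refl
      h2 : ∀ k → sub τ' (liftS σ k) ≡ θ k
      h2 zero = refl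
      h2 (suc k) = trans (sub-wk τ' (σ k)) (sym (wk²-as-sub (σ k)))

  sub-JreflTy : ∀ (σ : Sub) A C → sub (liftS σ) (JreflTy A C) ≡ JreflTy (sub σ A) (sub (liftS (liftS (liftS σ))) C)
  sub-JreflTy σ A C = trans-sym (sub-sub h1 C) (sub-sub h2 C)
    where
      τ' : Sub
      τ' = ext (ext (ext (λ k → var (suc k)) (var 0)) (var 0)) (rf (wk (sub σ A)) (var 0))
      θ : Sub
      θ = ext (ext (ext (λ k → wk (σ k)) (var 0)) (var 0)) (rf (wk (sub σ A)) (var 0))
      h1 : ∀ k → sub (liftS σ) (ext (ext (ext (λ k → var (suc k)) (var 0)) (var 0)) (rf (wk A) (var 0)) k) ≡ θ k
      h1 zero = cong₂ rf (wk-sub σ A) refl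
      h1 (suc zero) = refl
      h1 (suc (suc zero)) = refl
      h1 (suc (suc (suc k))) = refl
      h2 : ∀ k → sub τ' (liftS (liftS (liftS σ)) k) ≡ θ k
      h2 zero = refl
      h2 (suc zero) = refl
      h2 (suc (suc zero)) = refl
      h2 (suc (suc (suc k))) = trans (sub-wk τ' (wk (wk (σ k)))) (trans (sub-wk _ (wk (σ k))) (trans (sub-wk _ (σ k)) (sym (wk-as-sub (σ k)))))

  sub-stepTy : ∀ (σ : Sub) C → sub (liftS (liftS σ)) (stepTy C) ≡ stepTy (sub (liftS σ) C)
  sub-stepTy σ C = trans-sym (sub-sub h1 C) (sub-sub h2 C)
    where
      τ' : Sub
      τ' = ext (λ k → var (suc (suc k))) (su (var 1))
      θ : Sub
      θ = ext (λ k → wk (wk (σ k))) (su (var 1))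
      h1 : ∀ k → sub (liftS (liftS σ)) (ext (λ k → var (suc (suc k))) (su (var 1)) k) ≡ θ k
      h1 zero = refl
      h1 (suc k) = refl
      h2 : ∀ k → sub τ' (liftS σ k) ≡ θ k
      h2 zero = refl
      h2 (suc k) = trans (sub-wk τ' (σ k)) (sym (wk²-as-sub (σ k)))

  sub-cellTy : ∀ (σ : Sub) n α → sub σ (cellTy n α) ≡ cellTy n α
  sub-cellTy σ zero α = refl
  sub-cellTy σ (suc n) α = cong (λ X → `Id X (cell n (src α)) (cell n (tgt α))) (sub-cellTy σ n (src α))

  splitTy-pt : ∀ (σ : Sub) u v A B → ∀ k → sub (ext (ext σ u) v) (ext (λ k → var (suc (suc k))) (pair (wk (wk A)) (ren (liftR (λ k → suc (suc k))) B) (var 1) (var 0)) k)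
              ≡ ext σ (pair (sub σ A) (sub (liftS σ) B) u v) k
  splitTy-pt σ u v A B zero = cong₄ pair (wk²-ext² σ u v A) (sub-ren hB B) refl refl
    where
      hB : ∀ j → liftS (ext (ext σ u) v) (liftR (λ k → suc (suc k)) j) ≡ liftS σ j
      hB zero = refl
      hB (suc j) = refl
  splitTy-pt σ u v A B (suc k) = refl

  JreflTy-pt : ∀ (σ : Sub) u A → ∀ k → sub (ext σ u) (ext (ext (ext (λ k → var (suc k)) (var 0)) (var 0)) (rf (wk A) (var 0)) k)
              ≡ ext (ext (ext σ u) u) (rf (sub σ A) u) k
  JreflTy-pt σ u A zero = cong₂ rf (sub-ext-wk σ u A) refl
  JreflTy-pt σ u A (suc zero) = refl
  JreflTy-pt σ u A (suc (suc zero)) = refl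
  JreflTy-pt σ u A (suc (suc (suc k))) = refl

  stepTy-pt : ∀ (σ : Sub) m r → ∀ k → sub (ext (ext σ m) r) (ext (λ k → var (suc (suc k))) (su (var 1)) k) ≡ ext σ (su m) k
  stepTy-pt σ m r zero = refl
  stepTy-pt σ m r (suc k) = refl

  splitTy-ext : ∀ (σ : Sub) u v A B C → sub (ext (ext σ u) v) (splitTy A B C) ≡ sub (ext σ (pair (sub σ A) (sub (liftS σ) B) u v)) C
  splitTy-ext σ u v A B C = sub-sub (splitTy-pt σ u v A B) C

  JreflTy-ext : ∀ (σ : Sub) u A C → sub (ext σ u) (JreflTy A C) ≡ sub (ext (ext (ext σ u) u) (rf (sub σ A) u)) C
  JreflTy-ext σ u A C = sub-sub (JreflTy-pt σ u A) C

  stepTy-ext : ∀ (σ : Sub) m r C → sub (ext (ext σ m) r) (stepTy C) ≡ sub (ext σ (su m)) C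
  stepTy-ext σ m r C = sub-sub (stepTy-pt σ m r) C

  splitTy-sub : ∀ A B C a b → _[_,_] (splitTy A B C) a b ≡ C [ pair A B a b ]
  splitTy-sub A B C a b = trans (splitTy-ext var a b A B C) (cong (λ X → sub (ext var X) C) (cong₂ (λ X Y → pair X Y a b) (sub-var A) (sub-liftS-var B)))

  JreflTy-sub : ∀ A C a → (JreflTy A C) [ a ] ≡ _[_,_,_] C a a (rf A a)
  JreflTy-sub A C a = trans (JreflTy-ext var a A C) (cong (λ X → sub (ext (ext (ext var a) a) (rf X a)) C) (sub-var A))

  stepTy-sub : ∀ C n r → _[_,_] (stepTy C) n r ≡ C [ su n ]
  stepTy-sub C n r = stepTy-ext var n r C

  castTm : ∀ {Γ t A B} → A ≡ B → Γ ⊢ t ∶ A → Γ ⊢ t ∶ B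
  castTm refl d = d
  castTmT : ∀ {Γ t t' A} → t ≡ t' → Γ ⊢ t ∶ A → Γ ⊢ t' ∶ A
  castTmT refl d = d
  castTmEq : ∀ {Γ a b A B} → A ≡ B → Γ ⊢ a ≐ b ∶ A → Γ ⊢ a ≐ b ∶ B
  castTmEq refl d = d
  castTmEq2 : ∀ {Γ a b b' A B} → b ≡ b' → A ≡ B → Γ ⊢ a ≐ b ∶ A → Γ ⊢ a ≐ b' ∶ B
  castTmEq2 refl refl d = d
  castTy : ∀ {Γ A B} → A ≡ B → Γ ⊢ A type → Γ ⊢ B type
  castTy refl d = d
  castTyEq : ∀ {Γ A A' B B'} → A ≡ A' → B ≡ B' → Γ ⊢ A ≐ B type → Γ ⊢ A' ≐ B' type
  castTyEq refl refl d = d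
  castCtxTy : ∀ {Γ Γ' A} → Γ ≡ Γ' → Γ ⊢ A type → Γ' ⊢ A type
  castCtxTy refl d = d
  castCtxTyEq : ∀ {Γ Γ' A B} → Γ ≡ Γ' → Γ ⊢ A ≐ B type → Γ' ⊢ A ≐ B type
  castCtxTyEq refl d = d
  castVar : ∀ {Γ k A B} → A ≡ B → Γ ∋ k ⦂ A → Γ ∋ k ⦂ B
  castVar refl d = d

  -- Admissible structural rules

  wfTy : ∀ {Γ A} → Γ ⊢ A type → ⊢ Γ
  wfTyEq : ∀ {Γ A B} → Γ ⊢ A ≐ B type → ⊢ Γ
  wfTm : ∀ {Γ t A} → Γ ⊢ t ∶ A → ⊢ Γ
  wfTmEq : ∀ {Γ a b A} → Γ ⊢ a ≐ b ∶ A → ⊢ Γ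

  wfTy (ℕ-F w) = w
  wfTy (G-F w) = w
  wfTy (Π-F d _) = wfTy d
  wfTy (Σ-F d _) = wfTy d
  wfTy (Id-F d _ _) = wfTy d

  wfTyEq (ty-refl d) = wfTy d
  wfTyEq (ty-sym d) = wfTyEq d
  wfTyEq (ty-trans d _) = wfTyEq d
  wfTyEq (Π-cong d _ _) = wfTy d
  wfTyEq (Σ-cong d _ _) = wfTy d
  wfTyEq (Id-cong d _ _) = wfTyEq d

  wfTm (var-I w _) = w
  wfTm (conv d _) = wfTm d
  wfTm (Π-I d _) = wfTy d
  wfTm (Π-E _ d _) = wfTm d
  wfTm (Σ-I _ d _) = wfTm d
  wfTm (Σ-E _ _ d) = wfTm d
  wfTm (Id-I d) = wfTm d
  wfTm (Id-E d _ _ _) = wfTy d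
  wfTm (ℕ-I₀ w) = w
  wfTm (ℕ-I₁ d) = wfTm d
  wfTm (ℕ-E _ _ _ d) = wfTm d
  wfTm (cell-I n α w) = w

  wfTmEq (tm-refl d) = wfTm d
  wfTmEq (tm-sym d) = wfTmEq d
  wfTmEq (tm-trans d _) = wfTmEq d
  wfTmEq (tm-conv d _) = wfTmEq d
  wfTmEq (reflect d) = wfTm d
  wfTmEq (Π-β d _ _) = wfTy d
  wfTmEq (Σ-β _ _ _ d _) = wfTm d
  wfTmEq (Id-β d _ _ _) = wfTy d
  wfTmEq (ℕ-β₀ _ d _) = wfTm d
  wfTmEq (ℕ-β₁ _ _ _ d) = wfTm d
  wfTmEq (lam-cong d _ _) = wfTy d
  wfTmEq (app-cong d _ _ _) = wfTyEq d
  wfTmEq (pair-cong d _ _ _) = wfTyEq d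
  wfTmEq (split-cong d _ _ _ _) = wfTyEq d
  wfTmEq (rf-cong d _) = wfTyEq d
  wfTmEq (J-cong d _ _ _ _ _) = wfTyEq d
  wfTmEq (su-cong d) = wfTmEq d
  wfTmEq (natrec-cong _ _ _ d) = wfTmEq d
  wfTmEq (cell-idc n α w) = w

  wf-last : ∀ {Γ A} → ⊢ Γ ▹ A → Γ ⊢ A type
  wf-last (▹-wf d) = d

  data WfRen : Ctx → Sub → Ctx → Set where
    rbase : ∀ {Δ σ Γ} → ⊢ Δ → (∀ {k A} → Γ ∋ k ⦂ A → Σ ℕ (λ m → (σ k ≡ var m) × (Δ ∋ m ⦂ sub σ A))) → WfRen Δ σ Γ
    rlift : ∀ {Δ σ Γ A} → WfRen Δ σ Γ → WfRen (Δ ▹ sub σ A) (liftS σ) (Γ ▹ A)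

  rlook : ∀ {Δ σ Γ k A} → WfRen Δ σ Γ → Γ ∋ k ⦂ A → Σ ℕ (λ m → (σ k ≡ var m) × (Δ ∋ m ⦂ sub σ A))
  rlook (rbase _ f) x = f x
  rlook (rlift {σ = σ} g) (here {A = A}) = zero , refl , castVar (sym (wk-sub σ A)) here
  rlook (rlift {σ = σ} g) (there {A = A} x) with rlook g x
  ... | m , e , y = suc m , cong wk e , castVar (sym (wk-sub σ A)) (there y)

  renVar : ∀ {Δ σ Γ k A} → ⊢ Δ → WfRen Δ σ Γ → Γ ∋ k ⦂ A → Δ ⊢ σ k ∶ sub σ A
  renVar w g x with rlook g x
  ... | m , e , y = castTmT (sym e) (var-I w y)

  ctxEq : ∀ Δ (σ : Sub) A → (Δ ▹ sub σ A ▹ sub (liftS σ) (wk A) ▹ `Id (sub (liftS (liftS σ)) (wk (wk A))) (var 1) (var 0))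
                          ≡ (Δ ▹ sub σ A ▹ wk (sub σ A) ▹ `Id (wk (wk (sub σ A))) (var 1) (var 0))
  ctxEq Δ σ A = cong₂ (λ X Y → Δ ▹ sub σ A ▹ X ▹ `Id Y (var 1) (var 0)) (wk-sub σ A) (wk²-sub σ A)

  renWf : ∀ {Γ Δ σ} → ⊢ Γ → WfRen Δ σ Γ → ⊢ Δ
  renTy : ∀ {Γ Δ σ A} → Γ ⊢ A type → WfRen Δ σ Γ → Δ ⊢ sub σ A type
  renTyEq : ∀ {Γ Δ σ A B} → Γ ⊢ A ≐ B type → WfRen Δ σ Γ → Δ ⊢ sub σ A ≐ sub σ B type
  renTm : ∀ {Γ Δ σ t A} → Γ ⊢ t ∶ A → WfRen Δ σ Γ → Δ ⊢ sub σ t ∶ sub σ A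
  renTmEq : ∀ {Γ Δ σ a b A} → Γ ⊢ a ≐ b ∶ A → WfRen Δ σ Γ → Δ ⊢ sub σ a ≐ sub σ b ∶ sub σ A

  renTy (ℕ-F w) g = ℕ-F (renWf w g)
  renTy (G-F w) g = G-F (renWf w g)
  renTy (Π-F dA dB) g = Π-F (renTy dA g) (renTy dB (rlift g))
  renTy (Σ-F dA dB) g = Σ-F (renTy dA g) (renTy dB (rlift g))
  renTy (Id-F dA da db) g = Id-F (renTy dA g) (renTm da g) (renTm db g)

  renTyEq (ty-refl d) g = ty-refl (renTy d g)
  renTyEq (ty-sym d) g = ty-sym (renTyEq d g)
  renTyEq (ty-trans d e) g = ty-trans (renTyEq d g) (renTyEq e g)
  renTyEq (Π-cong dA eA eB) g = Π-cong (renTy dA g) (renTyEq eA g) (renTyEq eB (rlift g))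
  renTyEq (Σ-cong dA eA eB) g = Σ-cong (renTy dA g) (renTyEq eA g) (renTyEq eB (rlift g))
  renTyEq (Id-cong eA ea eb) g = Id-cong (renTyEq eA g) (renTmEq ea g) (renTmEq eb g)

  renTm (var-I w x) g = renVar (renWf w g) g x
  renTm (conv d e) g = conv (renTm d g) (renTyEq e g)
  renTm (Π-I dA db) g = Π-I (renTy dA g) (renTm db (rlift g))
  renTm {σ = σ} (Π-E {B = B} {a = a} dB df da) g =
    castTm (sym (sub-[] σ a B)) (Π-E (renTy dB (rlift g)) (renTm df g) (renTm da g))
  renTm {σ = σ} (Σ-I {B = B} {a = a} dB da db) g =
    Σ-I (renTy dB (rlift g)) (renTm da g) (castTm (sub-[] σ a B) (renTm db g))
  renTm {σ = σ} (Σ-E {A = A} {B = B} {C = C} {p = p} dC dd dp) g =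
    castTm (sym (sub-[] σ p C))
      (Σ-E (renTy dC (rlift g)) (castTm (sub-splitTy σ A B C) (renTm dd (rlift (rlift g)))) (renTm dp g))
  renTm (Id-I da) g = Id-I (renTm da g)
  renTm {Δ = Δ} {σ = σ} (Id-E {A = A} {C = C} {a = a} {b = b} {p = p} dA dC dd dp) g =
    castTm (sym (sub-[,,] σ a b p C))
      (Id-E (renTy dA g) (castCtxTy (ctxEq Δ σ A) (renTy dC (rlift (rlift (rlift g)))))
            (castTm (sub-JreflTy σ A C) (renTm dd (rlift g))) (renTm dp g))
  renTm (ℕ-I₀ w) g = ℕ-I₀ (renWf w g)
  renTm (ℕ-I₁ d) g = ℕ-I₁ (renTm d g)
  renTm {σ = σ} (ℕ-E {C = C} {n = n} dC dz ds dn) g =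
    castTm (sym (sub-[] σ n C))
      (ℕ-E (renTy dC (rlift g)) (castTm (sub-[] σ ze C) (renTm dz g))
           (castTm (sub-stepTy σ C) (renTm ds (rlift (rlift g)))) (renTm dn g))
  renTm {σ = σ} (cell-I n α w) g = castTm (sym (sub-cellTy σ n α)) (cell-I n α (renWf w g))

  renTmEq (tm-refl d) g = tm-refl (renTm d g)
  renTmEq (tm-sym d) g = tm-sym (renTmEq d g)
  renTmEq (tm-trans d e) g = tm-trans (renTmEq d g) (renTmEq e g)
  renTmEq (tm-conv d e) g = tm-conv (renTmEq d g) (renTyEq e g)
  renTmEq (reflect d) g = reflect (renTm d g)
  renTmEq {σ = σ} (Π-β {B = B} {b = b} {a = a} dA db da) g =
    castTmEq2 (sym (sub-[] σ a b)) (sym (sub-[] σ a B))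
      (Π-β (renTy dA g) (renTm db (rlift g)) (renTm da g))
  renTmEq {σ = σ} (Σ-β {A = A} {B = B} {C = C} {d = d} {a = a} {b = b} dC dd dB da db) g =
    castTmEq2 (sym (sub-[,] σ a b d)) (sym (sub-[] σ (pair A B a b) C))
      (Σ-β (renTy dC (rlift g)) (castTm (sub-splitTy σ A B C) (renTm dd (rlift (rlift g))))
           (renTy dB (rlift g)) (renTm da g) (castTm (sub-[] σ a B) (renTm db g)))
  renTmEq {Δ = Δ} {σ = σ} (Id-β {A = A} {C = C} {d = d} {a = a} dA dC dd da) g =
    castTmEq2 (sym (sub-[] σ a d)) (sym (sub-[,,] σ a a (rf A a) C))
      (Id-β (renTy dA g) (castCtxTy (ctxEq Δ σ A) (renTy dC (rlift (rlift (rlift g)))))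
            (castTm (sub-JreflTy σ A C) (renTm dd (rlift g))) (renTm da g))
  renTmEq {σ = σ} (ℕ-β₀ {C = C} dC dz ds) g =
    castTmEq (sym (sub-[] σ ze C))
      (ℕ-β₀ (renTy dC (rlift g)) (castTm (sub-[] σ ze C) (renTm dz g))
            (castTm (sub-stepTy σ C) (renTm ds (rlift (rlift g)))))
  renTmEq {σ = σ} (ℕ-β₁ {C = C} {z = z} {s = s} {n = n} dC dz ds dn) g =
    castTmEq2 (sym (sub-[,] σ n (natrec C z s n) s)) (sym (sub-[] σ (su n) C))
      (ℕ-β₁ (renTy dC (rlift g)) (castTm (sub-[] σ ze C) (renTm dz g))
            (castTm (sub-stepTy σ C) (renTm ds (rlift (rlift g)))) (renTm dn g))
  renTmEq (lam-cong dA eA eb) g = lam-cong (renTy dA g) (renTyEq eA g) (renTmEq eb (rlift g))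
  renTmEq {σ = σ} (app-cong {B = B} {a = a} eA eB ef ea) g =
    castTmEq (sym (sub-[] σ a B))
      (app-cong (renTyEq eA g) (renTyEq eB (rlift g)) (renTmEq ef g) (renTmEq ea g))
  renTmEq {σ = σ} (pair-cong {B = B} {a = a} eA eB ea eb) g =
    pair-cong (renTyEq eA g) (renTyEq eB (rlift g)) (renTmEq ea g) (castTmEq (sub-[] σ a B) (renTmEq eb g))
  renTmEq {σ = σ} (split-cong {A = A} {B = B} {C = C} {p = p} eA eB eC ed ep) g =
    castTmEq (sym (sub-[] σ p C))
      (split-cong (renTyEq eA g) (renTyEq eB (rlift g)) (renTyEq eC (rlift g))
         (castTmEq (sub-splitTy σ A B C) (renTmEq ed (rlift (rlift g)))) (renTmEq ep g))
  renTmEq (rf-cong eA ea) g = rf-cong (renTyEq eA g) (renTmEq ea g)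
  renTmEq {Δ = Δ} {σ = σ} (J-cong {A = A} {C = C} {a = a} {b = b} {p = p} eA eC ed ea eb ep) g =
    castTmEq (sym (sub-[,,] σ a b p C))
      (J-cong (renTyEq eA g) (castCtxTyEq (ctxEq Δ σ A) (renTyEq eC (rlift (rlift (rlift g)))))
         (castTmEq (sub-JreflTy σ A C) (renTmEq ed (rlift g))) (renTmEq ea g) (renTmEq eb g) (renTmEq ep g))
  renTmEq (su-cong d) g = su-cong (renTmEq d g)
  renTmEq {σ = σ} (natrec-cong {C = C} {n = n} eC ez es en) g =
    castTmEq (sym (sub-[] σ n C))
      (natrec-cong (renTyEq eC (rlift g)) (castTmEq (sub-[] σ ze C) (renTmEq ez g))
         (castTmEq (sub-stepTy σ C) (renTmEq es (rlift (rlift g)))) (renTmEq en g))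
  renTmEq {σ = σ} (cell-idc n α w) g =
    castTmEq2 (cong (λ X → rf X (cell n α)) (sym (sub-cellTy σ n α))) (sym (sub-cellTy σ (suc n) (idc α)))
      (cell-idc n α (renWf w g))

  renWf w (rbase w' _) = w'
  renWf (▹-wf dA) (rlift g) = ▹-wf (renTy dA g)

  castTmEq3 : ∀ {Γ a a' b b' A B} → a ≡ a' → b ≡ b' → A ≡ B → Γ ⊢ a ≐ b ∶ A → Γ ⊢ a' ≐ b' ∶ B
  castTmEq3 refl refl refl d = d

  wkRen : ∀ {Γ B} → ⊢ (Γ ▹ B) → WfRen (Γ ▹ B) (λ k → var (suc k)) Γ
  wkRen w = rbase w (λ {k} {A} x → suc k , refl , castVar (wk-as-sub A) (there x))

  wkTy : ∀ {Γ B A} → ⊢ (Γ ▹ B) → Γ ⊢ A type → Γ ▹ B ⊢ wk A type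
  wkTy {A = A} w d = castTy (sym (wk-as-sub A)) (renTy d (wkRen w))

  wkTyEq : ∀ {Γ B A A'} → ⊢ (Γ ▹ B) → Γ ⊢ A ≐ A' type → Γ ▹ B ⊢ wk A ≐ wk A' type
  wkTyEq {A = A} {A'} w d = castTyEq (sym (wk-as-sub A)) (sym (wk-as-sub A')) (renTyEq d (wkRen w))

  wkTm : ∀ {Γ B t A} → ⊢ (Γ ▹ B) → Γ ⊢ t ∶ A → Γ ▹ B ⊢ wk t ∶ wk A
  wkTm {t = t} {A} w d = castTmT (sym (wk-as-sub t)) (castTm (sym (wk-as-sub A)) (renTm d (wkRen w)))

  wkTmEq : ∀ {Γ B a b A} → ⊢ (Γ ▹ B) → Γ ⊢ a ≐ b ∶ A → Γ ▹ B ⊢ wk a ≐ wk b ∶ wk A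
  wkTmEq {a = a} {b} {A} w d = castTmEq3 (sym (wk-as-sub a)) (sym (wk-as-sub b)) (sym (wk-as-sub A)) (renTmEq d (wkRen w))

  wf-init : ∀ {Γ A} → ⊢ (Γ ▹ A) → ⊢ Γ
  wf-init w = wfTy (wf-last w)

  -- sconv and sctx lift a substitution under a context entry that is only
  -- judgmentally equal to the substituted type (context conversion).
  data WfSub : Ctx → Sub → Ctx → Set where
    sbase : ∀ {Δ σ Γ} → ⊢ Δ → (∀ {k A} → Γ ∋ k ⦂ A → Δ ⊢ σ k ∶ sub σ A) → WfSub Δ σ Γ
    slift : ∀ {Δ σ Γ A} → WfSub Δ σ Γ → WfSub (Δ ▹ sub σ A) (liftS σ) (Γ ▹ A)
    sconv : ∀ {Δ σ₀ σ Γ A} → WfSub Δ σ₀ Γ → WfSub Δ σ Γ → Δ ⊢ sub σ₀ A ≐ sub σ A type → WfSub (Δ ▹ sub σ₀ A) (liftS σ) (Γ ▹ A)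
    sext : ∀ {Δ σ Γ A u} → WfSub Δ σ Γ → Δ ⊢ u ∶ sub σ A → WfSub Δ (ext σ u) (Γ ▹ A)
    sctx : ∀ {Δ σ Γ A X} → WfSub Δ σ Γ → Δ ⊢ X type → Δ ⊢ X ≐ sub σ A type → WfSub (Δ ▹ X) (liftS σ) (Γ ▹ A)

  subVar : ∀ {Δ σ Γ k A} → ⊢ Δ → WfSub Δ σ Γ → Γ ∋ k ⦂ A → Δ ⊢ σ k ∶ sub σ A
  subVar w (sbase _ f) x = f x
  subVar w (slift {σ = σ} g) (here {A = A}) = castTm (sym (wk-sub σ A)) (var-I w here)
  subVar w (slift {σ = σ} g) (there {A = A} x) = castTm (sym (wk-sub σ A)) (wkTm w (subVar (wf-init w) g x))
  subVar w (sconv {σ = σ} g0 g e) (here {A = A}) = castTm (sym (wk-sub σ A)) (conv (var-I w here) (wkTyEq w e))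
  subVar w (sconv {σ = σ} g0 g e) (there {A = A} x) = castTm (sym (wk-sub σ A)) (wkTm w (subVar (wf-init w) g x))
  subVar w (sctx {σ = σ} g dX e) (here {A = A}) = castTm (sym (wk-sub σ A)) (conv (var-I w here) (wkTyEq w e))
  subVar w (sctx {σ = σ} g dX e) (there {A = A} x) = castTm (sym (wk-sub σ A)) (wkTm w (subVar (wf-init w) g x))
  subVar w (sext {σ = σ} {u = u} g du) (here {A = A}) = castTm (sym (sub-ext-wk σ u A)) du
  subVar w (sext {σ = σ} {u = u} g du) (there {A = A} x) = castTm (sym (sub-ext-wk σ u A)) (subVar w g x)

  subWf : ∀ {Γ Δ σ} → ⊢ Γ → WfSub Δ σ Γ → ⊢ Δ

  subTy : ∀ {Γ Δ σ A} → Γ ⊢ A type → WfSub Δ σ Γ → Δ ⊢ sub σ A type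
  subTyEq : ∀ {Γ Δ σ A B} → Γ ⊢ A ≐ B type → WfSub Δ σ Γ → Δ ⊢ sub σ A ≐ sub σ B type
  subTm : ∀ {Γ Δ σ t A} → Γ ⊢ t ∶ A → WfSub Δ σ Γ → Δ ⊢ sub σ t ∶ sub σ A
  subTmEq : ∀ {Γ Δ σ a b A} → Γ ⊢ a ≐ b ∶ A → WfSub Δ σ Γ → Δ ⊢ sub σ a ≐ sub σ b ∶ sub σ A

  subTy (ℕ-F w) g = ℕ-F (subWf w g)
  subTy (G-F w) g = G-F (subWf w g)
  subTy (Π-F dA dB) g = Π-F (subTy dA g) (subTy dB (slift g))
  subTy (Σ-F dA dB) g = Σ-F (subTy dA g) (subTy dB (slift g))
  subTy (Id-F dA da db) g = Id-F (subTy dA g) (subTm da g) (subTm db g)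

  subTyEq (ty-refl d) g = ty-refl (subTy d g)
  subTyEq (ty-sym d) g = ty-sym (subTyEq d g)
  subTyEq (ty-trans d e) g = ty-trans (subTyEq d g) (subTyEq e g)
  subTyEq (Π-cong dA eA eB) g = Π-cong (subTy dA g) (subTyEq eA g) (subTyEq eB (slift g))
  subTyEq (Σ-cong dA eA eB) g = Σ-cong (subTy dA g) (subTyEq eA g) (subTyEq eB (slift g))
  subTyEq (Id-cong eA ea eb) g = Id-cong (subTyEq eA g) (subTmEq ea g) (subTmEq eb g)

  subTm (var-I w x) g = subVar (subWf w g) g x
  subTm (conv d e) g = conv (subTm d g) (subTyEq e g)
  subTm (Π-I dA db) g = Π-I (subTy dA g) (subTm db (slift g))
  subTm {σ = σ} (Π-E {B = B} {a = a} dB df da) g =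
    castTm (sym (sub-[] σ a B)) (Π-E (subTy dB (slift g)) (subTm df g) (subTm da g))
  subTm {σ = σ} (Σ-I {B = B} {a = a} dB da db) g =
    Σ-I (subTy dB (slift g)) (subTm da g) (castTm (sub-[] σ a B) (subTm db g))
  subTm {σ = σ} (Σ-E {A = A} {B = B} {C = C} {p = p} dC dd dp) g =
    castTm (sym (sub-[] σ p C))
      (Σ-E (subTy dC (slift g)) (castTm (sub-splitTy σ A B C) (subTm dd (slift (slift g)))) (subTm dp g))
  subTm (Id-I da) g = Id-I (subTm da g)
  subTm {Δ = Δ} {σ = σ} (Id-E {A = A} {C = C} {a = a} {b = b} {p = p} dA dC dd dp) g =
    castTm (sym (sub-[,,] σ a b p C))
      (Id-E (subTy dA g) (castCtxTy (ctxEq Δ σ A) (subTy dC (slift (slift (slift g)))))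
            (castTm (sub-JreflTy σ A C) (subTm dd (slift g))) (subTm dp g))
  subTm (ℕ-I₀ w) g = ℕ-I₀ (subWf w g)
  subTm (ℕ-I₁ d) g = ℕ-I₁ (subTm d g)
  subTm {σ = σ} (ℕ-E {C = C} {n = n} dC dz ds dn) g =
    castTm (sym (sub-[] σ n C))
      (ℕ-E (subTy dC (slift g)) (castTm (sub-[] σ ze C) (subTm dz g))
           (castTm (sub-stepTy σ C) (subTm ds (slift (slift g)))) (subTm dn g))
  subTm {σ = σ} (cell-I n α w) g = castTm (sym (sub-cellTy σ n α)) (cell-I n α (subWf w g))

  subTmEq (tm-refl d) g = tm-refl (subTm d g)
  subTmEq (tm-sym d) g = tm-sym (subTmEq d g)
  subTmEq (tm-trans d e) g = tm-trans (subTmEq d g) (subTmEq e g)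
  subTmEq (tm-conv d e) g = tm-conv (subTmEq d g) (subTyEq e g)
  subTmEq (reflect d) g = reflect (subTm d g)
  subTmEq {σ = σ} (Π-β {B = B} {b = b} {a = a} dA db da) g =
    castTmEq2 (sym (sub-[] σ a b)) (sym (sub-[] σ a B))
      (Π-β (subTy dA g) (subTm db (slift g)) (subTm da g))
  subTmEq {σ = σ} (Σ-β {A = A} {B = B} {C = C} {d = d} {a = a} {b = b} dC dd dB da db) g =
    castTmEq2 (sym (sub-[,] σ a b d)) (sym (sub-[] σ (pair A B a b) C))
      (Σ-β (subTy dC (slift g)) (castTm (sub-splitTy σ A B C) (subTm dd (slift (slift g))))
           (subTy dB (slift g)) (subTm da g) (castTm (sub-[] σ a B) (subTm db g)))
  subTmEq {Δ = Δ} {σ = σ} (Id-β {A = A} {C = C} {d = d} {a = a} dA dC dd da) g =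
    castTmEq2 (sym (sub-[] σ a d)) (sym (sub-[,,] σ a a (rf A a) C))
      (Id-β (subTy dA g) (castCtxTy (ctxEq Δ σ A) (subTy dC (slift (slift (slift g)))))
            (castTm (sub-JreflTy σ A C) (subTm dd (slift g))) (subTm da g))
  subTmEq {σ = σ} (ℕ-β₀ {C = C} dC dz ds) g =
    castTmEq (sym (sub-[] σ ze C))
      (ℕ-β₀ (subTy dC (slift g)) (castTm (sub-[] σ ze C) (subTm dz g))
            (castTm (sub-stepTy σ C) (subTm ds (slift (slift g)))))
  subTmEq {σ = σ} (ℕ-β₁ {C = C} {z = z} {s = s} {n = n} dC dz ds dn) g =
    castTmEq2 (sym (sub-[,] σ n (natrec C z s n) s)) (sym (sub-[] σ (su n) C))
      (ℕ-β₁ (subTy dC (slift g)) (castTm (sub-[] σ ze C) (subTm dz g))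
            (castTm (sub-stepTy σ C) (subTm ds (slift (slift g)))) (subTm dn g))
  subTmEq (lam-cong dA eA eb) g = lam-cong (subTy dA g) (subTyEq eA g) (subTmEq eb (slift g))
  subTmEq {σ = σ} (app-cong {B = B} {a = a} eA eB ef ea) g =
    castTmEq (sym (sub-[] σ a B))
      (app-cong (subTyEq eA g) (subTyEq eB (slift g)) (subTmEq ef g) (subTmEq ea g))
  subTmEq {σ = σ} (pair-cong {B = B} {a = a} eA eB ea eb) g =
    pair-cong (subTyEq eA g) (subTyEq eB (slift g)) (subTmEq ea g) (castTmEq (sub-[] σ a B) (subTmEq eb g))
  subTmEq {σ = σ} (split-cong {A = A} {B = B} {C = C} {p = p} eA eB eC ed ep) g =
    castTmEq (sym (sub-[] σ p C))
      (split-cong (subTyEq eA g) (subTyEq eB (slift g)) (subTyEq eC (slift g))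
         (castTmEq (sub-splitTy σ A B C) (subTmEq ed (slift (slift g)))) (subTmEq ep g))
  subTmEq (rf-cong eA ea) g = rf-cong (subTyEq eA g) (subTmEq ea g)
  subTmEq {Δ = Δ} {σ = σ} (J-cong {A = A} {C = C} {a = a} {b = b} {p = p} eA eC ed ea eb ep) g =
    castTmEq (sym (sub-[,,] σ a b p C))
      (J-cong (subTyEq eA g) (castCtxTyEq (ctxEq Δ σ A) (subTyEq eC (slift (slift (slift g)))))
         (castTmEq (sub-JreflTy σ A C) (subTmEq ed (slift g))) (subTmEq ea g) (subTmEq eb g) (subTmEq ep g))
  subTmEq (su-cong d) g = su-cong (subTmEq d g)
  subTmEq {σ = σ} (natrec-cong {C = C} {n = n} eC ez es en) g =
    castTmEq (sym (sub-[] σ n C))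
      (natrec-cong (subTyEq eC (slift g)) (castTmEq (sub-[] σ ze C) (subTmEq ez g))
         (castTmEq (sub-stepTy σ C) (subTmEq es (slift (slift g)))) (subTmEq en g))
  subTmEq {σ = σ} (cell-idc n α w) g =
    castTmEq2 (cong (λ X → rf X (cell n α)) (sym (sub-cellTy σ n α))) (sym (sub-cellTy σ (suc n) (idc α)))
      (cell-idc n α (subWf w g))

  subWf w (sbase w' _) = w'
  subWf (▹-wf dA) (slift g) = ▹-wf (subTy dA g)
  subWf (▹-wf dA) (sconv g0 g e) = ▹-wf (subTy dA g0)
  subWf w (sext g du) = wfTm du
  subWf w (sctx g dX e) = ▹-wf dX

  lookupTy : ∀ {Γ k A} → ⊢ Γ → Γ ∋ k ⦂ A → Γ ⊢ A type
  lookupTy w here = wkTy w (wf-last w)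
  lookupTy w (there x) = wkTy w (lookupTy (wf-init w) x)

  idSub : ∀ {Γ} → ⊢ Γ → WfSub Γ var Γ
  idSub w = sbase w (λ {k} {A} x → castTm (sym (sub-var A)) (var-I w x))

  singleSub : ∀ {Γ A a} → Γ ⊢ a ∶ A → WfSub Γ (ext var a) (Γ ▹ A)
  singleSub {A = A} da = sext (idSub (wfTm da)) (castTm (sym (sub-var A)) da)

  doubleSub : ∀ {Γ A B a b} → Γ ⊢ a ∶ A → Γ ⊢ b ∶ B [ a ] → WfSub Γ (ext (ext var a) b) (Γ ▹ A ▹ B)
  doubleSub da db = sext (singleSub da) db

  JSub : ∀ {Γ A a b p} → Γ ⊢ a ∶ A → Γ ⊢ b ∶ A → Γ ⊢ p ∶ `Id A a b
     → WfSub Γ (ext (ext (ext var a) b) p) (Γ ▹ A ▹ wk A ▹ `Id (wk (wk A)) (var 1) (var 0))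
  JSub {A = A} {a} {b} da db dp =
    sext (sext (singleSub da) (castTm (sym (trans (sub-ext-wk var a A) (sub-var A))) db))
         (castTm (cong (λ X → `Id X a b) (sym (trans (wk²-ext² var a b A) (sub-var A)))) dp)

  ctxConvSub : ∀ {Γ X A} → Γ ⊢ X type → Γ ⊢ X ≐ A type → WfSub (Γ ▹ X) (liftS var) (Γ ▹ A)
  ctxConvSub {A = A} dX e = sctx (idSub (wfTy dX)) dX (castTyEq refl (sym (sub-var A)) e)

  convCtxTy : ∀ {Γ X A B} → Γ ⊢ X type → Γ ⊢ X ≐ A type → Γ ▹ A ⊢ B type → Γ ▹ X ⊢ B type
  convCtxTy {B = B} dX e d = castTy (sub-liftS-var B) (subTy d (ctxConvSub dX e))

  convCtxTyEq : ∀ {Γ X A B B'} → Γ ⊢ X type → Γ ⊢ X ≐ A type → Γ ▹ A ⊢ B ≐ B' type → Γ ▹ X ⊢ B ≐ B' type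
  convCtxTyEq {B = B} {B'} dX e d = castTyEq (sub-liftS-var B) (sub-liftS-var B') (subTyEq d (ctxConvSub dX e))

  convCtxTm : ∀ {Γ X A t B} → Γ ⊢ X type → Γ ⊢ X ≐ A type → Γ ▹ A ⊢ t ∶ B → Γ ▹ X ⊢ t ∶ B
  convCtxTm {t = t} {B} dX e d = castTmT (sub-liftS-var t) (castTm (sub-liftS-var B) (subTm d (ctxConvSub dX e)))

  cellTy-tgt≡src : ∀ n (α : Cell (suc n)) → cellTy n (tgt α) ≡ cellTy n (src α)
  cellTy-tgt≡src zero α = refl
  cellTy-tgt≡src (suc m) α = cong₂ (λ x y → `Id (cellTy m x) (cell m x) (cell m y)) (sym (glob-s α)) (sym (glob-t α))

  cellTy-wf : ∀ {Γ} → ⊢ Γ → ∀ n α → Γ ⊢ cellTy n α type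
  cellTy-wf w zero α = G-F w
  cellTy-wf w (suc n) α = Id-F (cellTy-wf w n (src α)) (cell-I n (src α) w) (castTm (cellTy-tgt≡src n α) (cell-I n (tgt α) w))

  cellTy-idc : ∀ n (α : Cell n) → `Id (cellTy n α) (cell n α) (cell n α) ≡ cellTy (suc n) (idc α)
  cellTy-idc n α = cong₂ (λ x y → `Id (cellTy n x) (cell n x) (cell n y)) (sym (refl-s α)) (sym (refl-t α))

  Id-F-inv : ∀ {Γ A a b} → Γ ⊢ `Id A a b type → (Γ ⊢ A type) × (Γ ⊢ a ∶ A) × (Γ ⊢ b ∶ A)
  Id-F-inv (Id-F dA da db) = dA , da , db

  Π-F-inv : ∀ {Γ A B} → Γ ⊢ `Π A B type → (Γ ⊢ A type) × (Γ ▹ A ⊢ B type)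
  Π-F-inv (Π-F dA dB) = dA , dB

  -- Functionality of substitution and presuppositions

  data EqSub : Ctx → Sub → Sub → Ctx → Set where
    erefl : ∀ {Δ σ Γ} → ⊢ Γ → WfSub Δ σ Γ → EqSub Δ σ σ Γ
    elift : ∀ {Δ σ₀ σ σ' Γ A} → WfSub Δ σ₀ Γ → EqSub Δ σ σ' Γ → Δ ⊢ sub σ₀ A ≐ sub σ A type → Δ ⊢ sub σ₀ A ≐ sub σ' A type
          → EqSub (Δ ▹ sub σ₀ A) (liftS σ) (liftS σ') (Γ ▹ A)
    eext : ∀ {Δ σ σ' Γ A u u'} → EqSub Δ σ σ' Γ → Δ ⊢ u ∶ sub σ A → Δ ⊢ u' ∶ sub σ' A → Δ ⊢ u ≐ u' ∶ sub σ A
         → Δ ⊢ sub σ A ≐ sub σ' A type → EqSub Δ (ext σ u) (ext σ' u') (Γ ▹ A)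

  eqSubˡ : ∀ {Δ σ σ' Γ} → EqSub Δ σ σ' Γ → WfSub Δ σ Γ
  eqSubˡ (erefl _ g) = g
  eqSubˡ (elift g0 e q q') = sconv g0 (eqSubˡ e) q
  eqSubˡ (eext e u u' _ _) = sext (eqSubˡ e) u

  eqSubʳ : ∀ {Δ σ σ' Γ} → EqSub Δ σ σ' Γ → WfSub Δ σ' Γ
  eqSubʳ (erefl _ g) = g
  eqSubʳ (elift g0 e q q') = sconv g0 (eqSubʳ e) q'
  eqSubʳ (eext e u u' _ _) = sext (eqSubʳ e) u'

  eqSub-sym : ∀ {Δ σ σ' Γ} → EqSub Δ σ σ' Γ → EqSub Δ σ' σ Γ
  eqSub-sym (erefl w g) = erefl w g
  eqSub-sym (elift g0 e q q') = elift g0 (eqSub-sym e) q' q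
  eqSub-sym (eext e u u' eq teq) = eext (eqSub-sym e) u' u (tm-sym (tm-conv eq teq)) (ty-sym teq)

  eqSub-diagʳ : ∀ {Δ σ σ' Γ} → EqSub Δ σ σ' Γ → EqSub Δ σ' σ' Γ
  eqSub-diagʳ (erefl w g) = erefl w g
  eqSub-diagʳ (elift g0 e q q') = elift g0 (eqSub-diagʳ e) q' q'
  eqSub-diagʳ (eext e u u' eq teq) = eext (eqSub-diagʳ e) u' u' (tm-refl u') (ty-trans (ty-sym teq) teq)

  eqSub-var : ∀ {Δ σ σ' Γ k A} → ⊢ Δ → EqSub Δ σ σ' Γ → Γ ∋ k ⦂ A → (Δ ⊢ σ k ≐ σ' k ∶ sub σ A) × (Δ ⊢ sub σ A ≐ sub σ' A type)
  eqSub-var wΔ (erefl w g) x = tm-refl (subVar wΔ g x) , ty-refl (subTy (lookupTy w x) g)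
  eqSub-var wΔ (elift {σ = σ} {σ'} g0 e q q') (here {A = A}) =
    castTmEq (sym (wk-sub σ A)) (tm-refl (conv (var-I wΔ here) (wkTyEq wΔ q))) ,
    castTyEq (sym (wk-sub σ A)) (sym (wk-sub σ' A)) (wkTyEq wΔ (ty-trans (ty-sym q) q'))
  eqSub-var wΔ (elift {σ = σ} {σ'} g0 e q q') (there {A = A} x) with eqSub-var (wf-init wΔ) e x
  ... | h1 , h2 = castTmEq (sym (wk-sub σ A)) (wkTmEq wΔ h1) , castTyEq (sym (wk-sub σ A)) (sym (wk-sub σ' A)) (wkTyEq wΔ h2)
  eqSub-var wΔ (eext {σ = σ} {σ'} {u = u} {u'} e du du' eq teq) (here {A = A}) =
    castTmEq (sym (sub-ext-wk σ u A)) eq , castTyEq (sym (sub-ext-wk σ u A)) (sym (sub-ext-wk σ' u' A)) teq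
  eqSub-var wΔ (eext {σ = σ} {σ'} {u = u} {u'} e du du' eq teq) (there {A = A} x) with eqSub-var wΔ e x
  ... | h1 , h2 = castTmEq (sym (sub-ext-wk σ u A)) h1 , castTyEq (sym (sub-ext-wk σ u A)) (sym (sub-ext-wk σ' u' A)) h2

  Id-invˡ : ∀ {Γ T T' A a b} → Γ ⊢ T ≐ T' type → T ≡ `Id A a b →
    Σ[ A' ∈ Tm ] Σ[ a' ∈ Tm ] Σ[ b' ∈ Tm ] (T' ≡ `Id A' a' b') × (Γ ⊢ A ≐ A' type) × (Γ ⊢ a ≐ a' ∶ A) × (Γ ⊢ b ≐ b' ∶ A)
  Id-invʳ : ∀ {Γ T T' A' a' b'} → Γ ⊢ T ≐ T' type → T' ≡ `Id A' a' b' →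
    Σ[ A ∈ Tm ] Σ[ a ∈ Tm ] Σ[ b ∈ Tm ] (T ≡ `Id A a b) × (Γ ⊢ A ≐ A' type) × (Γ ⊢ a ≐ a' ∶ A) × (Γ ⊢ b ≐ b' ∶ A)
  Id-invˡ (ty-refl (Id-F dA da db)) refl = _ , _ , _ , refl , ty-refl dA , tm-refl da , tm-refl db
  Id-invˡ (ty-refl (ℕ-F _)) ()
  Id-invˡ (ty-refl (G-F _)) ()
  Id-invˡ (ty-refl (Π-F _ _)) ()
  Id-invˡ (ty-refl (Σ-F _ _)) ()
  Id-invˡ (ty-sym d) eq with Id-invʳ d eq
  ... | A0 , a0 , b0 , e , eA , ea , eb = A0 , a0 , b0 , e , ty-sym eA , tm-sym (tm-conv ea eA) , tm-sym (tm-conv eb eA)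
  Id-invˡ (ty-trans d1 d2) eq with Id-invˡ d1 eq
  ... | A1 , a1 , b1 , e1 , eA1 , ea1 , eb1 with Id-invˡ d2 e1
  ... | A2 , a2 , b2 , e2 , eA2 , ea2 , eb2 =
    A2 , a2 , b2 , e2 , ty-trans eA1 eA2 , tm-trans ea1 (tm-conv ea2 (ty-sym eA1)) , tm-trans eb1 (tm-conv eb2 (ty-sym eA1))
  Id-invˡ (Π-cong _ _ _) ()
  Id-invˡ (Σ-cong _ _ _) ()
  Id-invˡ (Id-cong eA ea eb) refl = _ , _ , _ , refl , eA , ea , eb
  Id-invʳ (ty-refl (Id-F dA da db)) refl = _ , _ , _ , refl , ty-refl dA , tm-refl da , tm-refl db
  Id-invʳ (ty-refl (ℕ-F _)) ()
  Id-invʳ (ty-refl (G-F _)) ()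
  Id-invʳ (ty-refl (Π-F _ _)) ()
  Id-invʳ (ty-refl (Σ-F _ _)) ()
  Id-invʳ (ty-sym d) eq with Id-invˡ d eq
  ... | A0 , a0 , b0 , e , eA , ea , eb = A0 , a0 , b0 , e , ty-sym eA , tm-conv (tm-sym ea) eA , tm-conv (tm-sym eb) eA
  Id-invʳ (ty-trans d1 d2) eq with Id-invʳ d2 eq
  ... | A1 , a1 , b1 , e1 , eA1 , ea1 , eb1 with Id-invʳ d1 e1
  ... | A0 , a0 , b0 , e0 , eA0 , ea0 , eb0 =
    A0 , a0 , b0 , e0 , ty-trans eA0 eA1 , tm-trans ea0 (tm-conv ea1 (ty-sym eA0)) , tm-trans eb0 (tm-conv eb1 (ty-sym eA0))
  Id-invʳ (Π-cong _ _ _) ()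
  Id-invʳ (Σ-cong _ _ _) ()
  Id-invʳ (Id-cong eA ea eb) refl = _ , _ , _ , refl , eA , ea , eb

  Id-cong-inv : ∀ {Γ A a b A' a' b'} → Γ ⊢ `Id A a b ≐ `Id A' a' b' type → (Γ ⊢ A ≐ A' type) × (Γ ⊢ a ≐ a' ∶ A) × (Γ ⊢ b ≐ b' ∶ A)
  Id-cong-inv d with Id-invˡ d refl
  ... | _ , _ , _ , refl , eA , ea , eb = eA , ea , eb

  Σ-invˡ : ∀ {Γ T T' A B X} → Γ ⊢ T ≐ T' type → T ≡ `Σ A B → Γ ⊢ X type → Γ ⊢ X ≐ A type →
    Σ[ A' ∈ Tm ] Σ[ B' ∈ Tm ] (T' ≡ `Σ A' B') × (Γ ⊢ A ≐ A' type) × (Γ ▹ X ⊢ B ≐ B' type)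
  Σ-invʳ : ∀ {Γ T T' A' B' X} → Γ ⊢ T ≐ T' type → T' ≡ `Σ A' B' → Γ ⊢ X type → Γ ⊢ X ≐ A' type →
    Σ[ A ∈ Tm ] Σ[ B ∈ Tm ] (T ≡ `Σ A B) × (Γ ⊢ A ≐ A' type) × (Γ ▹ X ⊢ B ≐ B' type)
  Σ-invˡ (ty-refl (Σ-F dA dB)) refl dX eX = _ , _ , refl , ty-refl dA , ty-refl (convCtxTy dX eX dB)
  Σ-invˡ (ty-refl (ℕ-F _)) ()
  Σ-invˡ (ty-refl (G-F _)) ()
  Σ-invˡ (ty-refl (Π-F _ _)) ()
  Σ-invˡ (ty-refl (Id-F _ _ _)) ()
  Σ-invˡ (ty-sym d) eq dX eX with Σ-invʳ d eq dX eX
  ... | A0 , B0 , e , eA , eB = A0 , B0 , e , ty-sym eA , ty-sym eB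
  Σ-invˡ (ty-trans d1 d2) eq dX eX with Σ-invˡ d1 eq dX eX
  ... | A1 , B1 , e1 , eA1 , eB1 with Σ-invˡ d2 e1 dX (ty-trans eX eA1)
  ... | A2 , B2 , e2 , eA2 , eB2 = A2 , B2 , e2 , ty-trans eA1 eA2 , ty-trans eB1 eB2
  Σ-invˡ (Π-cong _ _ _) ()
  Σ-invˡ (Id-cong _ _ _) ()
  Σ-invˡ (Σ-cong dA eA eB) refl dX eX = _ , _ , refl , eA , convCtxTyEq dX eX eB
  Σ-invʳ (ty-refl (Σ-F dA dB)) refl dX eX = _ , _ , refl , ty-refl dA , ty-refl (convCtxTy dX eX dB)
  Σ-invʳ (ty-refl (ℕ-F _)) ()
  Σ-invʳ (ty-refl (G-F _)) ()
  Σ-invʳ (ty-refl (Π-F _ _)) ()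
  Σ-invʳ (ty-refl (Id-F _ _ _)) ()
  Σ-invʳ (ty-sym d) eq dX eX with Σ-invˡ d eq dX eX
  ... | A0 , B0 , e , eA , eB = A0 , B0 , e , ty-sym eA , ty-sym eB
  Σ-invʳ (ty-trans d1 d2) eq dX eX with Σ-invʳ d2 eq dX eX
  ... | A1 , B1 , e1 , eA1 , eB1 with Σ-invʳ d1 e1 dX (ty-trans eX (ty-sym eA1))
  ... | A0 , B0 , e0 , eA0 , eB0 = A0 , B0 , e0 , ty-trans eA0 eA1 , ty-trans eB0 eB1
  Σ-invʳ (Π-cong _ _ _) ()
  Σ-invʳ (Id-cong _ _ _) ()
  Σ-invʳ (Σ-cong dA eA eB) refl dX eX = _ , _ , refl , eA , convCtxTyEq dX (ty-trans eX (ty-sym eA)) eB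

  Σ-cong-inv : ∀ {Γ A B A' B'} → Γ ⊢ A type → Γ ⊢ `Σ A B ≐ `Σ A' B' type → (Γ ⊢ A ≐ A' type) × (Γ ▹ A ⊢ B ≐ B' type)
  Σ-cong-inv dA d with Σ-invˡ d refl dA (ty-refl dA)
  ... | _ , _ , refl , eA , eB = eA , eB

  eqSub-lift : ∀ {Δ σ σ' Γ A} → EqSub Δ σ σ' Γ → Δ ⊢ sub σ A ≐ sub σ' A type → EqSub (Δ ▹ sub σ A) (liftS σ) (liftS σ') (Γ ▹ A)
  eqSub-lift e q = elift (eqSubˡ e) e (ty-trans q (ty-sym q)) q

  eqSub-single : ∀ {Γ A a a'} → Γ ⊢ A type → Γ ⊢ a ∶ A → Γ ⊢ a' ∶ A → Γ ⊢ a ≐ a' ∶ A → EqSub Γ (ext var a) (ext var a') (Γ ▹ A)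
  eqSub-single {A = A} dA da da' ea =
    eext (erefl (wfTm da) (idSub (wfTm da))) (castTm (sym (sub-var A)) da) (castTm (sym (sub-var A)) da')
         (castTmEq (sym (sub-var A)) ea) (ty-refl (castTy (sym (sub-var A)) dA))

  eqSub-ext₃ : ∀ {Δ σ σ' Γ A u u' v v' p p'} → EqSub Δ σ σ' Γ →
    Δ ⊢ u ∶ sub σ A → Δ ⊢ u' ∶ sub σ' A → Δ ⊢ u ≐ u' ∶ sub σ A →
    Δ ⊢ v ∶ sub σ A → Δ ⊢ v' ∶ sub σ' A → Δ ⊢ v ≐ v' ∶ sub σ A →
    Δ ⊢ p ∶ `Id (sub σ A) u v → Δ ⊢ p' ∶ `Id (sub σ' A) u' v' → Δ ⊢ p ≐ p' ∶ `Id (sub σ A) u v →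
    Δ ⊢ sub σ A ≐ sub σ' A type →
    EqSub Δ (ext (ext (ext σ u) v) p) (ext (ext (ext σ' u') v') p') (Γ ▹ A ▹ wk A ▹ `Id (wk (wk A)) (var 1) (var 0))
  eqSub-ext₃ {σ = σ} {σ'} {A = A} {u} {u'} {v} {v'} e du du' eu dv dv' ev dp dp' ep qA =
    eext (eext (eext e du du' eu qA)
               (castTm (sym (sub-ext-wk σ u A)) dv) (castTm (sym (sub-ext-wk σ' u' A)) dv')
               (castTmEq (sym (sub-ext-wk σ u A)) ev) (castTyEq (sym (sub-ext-wk σ u A)) (sym (sub-ext-wk σ' u' A)) qA))
         (castTm (cong (λ X → `Id X u v) (sym (wk²-ext² σ u v A))) dp)
         (castTm (cong (λ X → `Id X u' v') (sym (wk²-ext² σ' u' v' A))) dp')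
         (castTmEq (cong (λ X → `Id X u v) (sym (wk²-ext² σ u v A))) ep)
         (castTyEq (cong (λ X → `Id X u v) (sym (wk²-ext² σ u v A))) (cong (λ X → `Id X u' v') (sym (wk²-ext² σ' u' v' A)))
                   (Id-cong qA eu ev))

  eqSub-lift₃ : ∀ {Δ σ σ' Γ A} → EqSub Δ σ σ' Γ → Δ ⊢ sub σ A type → Δ ⊢ sub σ A ≐ sub σ' A type →
    EqSub (Δ ▹ sub σ A ▹ sub (liftS σ) (wk A) ▹ `Id (sub (liftS (liftS σ)) (wk (wk A))) (var 1) (var 0))
         (liftS (liftS (liftS σ))) (liftS (liftS (liftS σ'))) (Γ ▹ A ▹ wk A ▹ `Id (wk (wk A)) (var 1) (var 0))
  eqSub-lift₃ {σ = σ} {σ'} {A = A} e sA qA = eqSub-lift (eqSub-lift (eqSub-lift e qA) q2) q3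
    where
      w1 = ▹-wf sA
      q2 = castTyEq (sym (wk-sub σ A)) (sym (wk-sub σ' A)) (wkTyEq w1 qA)
      sWA = castTy (sym (wk-sub σ A)) (wkTy w1 sA)
      w2 = ▹-wf sWA
      v1 = castTm (sym (wk²-sub σ A)) (var-I w2 (there here))
      v0 = castTm (sym (wk-sub (liftS σ) (wk A))) (var-I w2 here)
      q3A = castTyEq (sym (wk²-sub σ A)) (sym (wk²-sub σ' A)) (wkTyEq w2 (wkTyEq w1 qA))
      q3 = Id-cong q3A (tm-refl v1) (tm-refl v0)

  wk₂ : Sub
  wk₂ k = var (suc (suc k))

  wk₂Sub : ∀ {Γ A1 B1} → ⊢ (Γ ▹ A1 ▹ B1) → WfSub (Γ ▹ A1 ▹ B1) wk₂ Γ
  wk₂Sub w = sbase w (λ {k} {A} x → castTm (wk²-as-sub A) (var-I w (there (there x))))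

  wkSub : ∀ {Γ A1} → ⊢ (Γ ▹ A1) → WfSub (Γ ▹ A1) (λ k → var (suc k)) Γ
  wkSub w = sbase w (λ {k} {A} x → castTm (wk-as-sub A) (var-I w (there x)))

  wk-as-sub-wk₂ : ∀ B → wk B ≡ (sub (liftS wk₂) B) [ var 1 ]
  wk-as-sub-wk₂ B = trans (ren-as-sub h B) (sym (lift-ext wk₂ (var 1) B))
    where h : ∀ k → var (suc k) ≡ ext wk₂ (var 1) k
          h zero = refl
          h (suc j) = refl

  splitPair-as-sub : ∀ A B → pair (sub wk₂ A) (sub (liftS wk₂) B) (var 1) (var 0) ≡ pair (wk (wk A)) (ren (liftR (λ k → suc (suc k))) B) (var 1) (var 0)
  splitPair-as-sub A B = cong₂ (λ X Y → pair X Y (var 1) (var 0)) (sym (wk²-as-sub A)) (sym (ren-as-sub h2 B))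
    where h2 : ∀ k → var (liftR (λ k → suc (suc k)) k) ≡ liftS wk₂ k
          h2 zero = refl
          h2 (suc j) = refl

  splitPair-fst : ∀ {Γ A A1 B1} → ⊢ (Γ ▹ A1 ▹ B1) → Γ ⊢ A1 ≐ A type → (Γ ▹ A1 ▹ B1) ⊢ var 1 ∶ sub wk₂ A
  splitPair-fst {A = A} w eA = castTm (wk²-as-sub A) (conv (var-I w (there here)) (wkTyEq w (wkTyEq (▹-wf (wf-last (wf-init w))) eA)))
  splitPair-snd : ∀ {Γ A1 B1 B} → ⊢ (Γ ▹ A1 ▹ B1) → Γ ▹ A1 ⊢ B1 ≐ B type → (Γ ▹ A1 ▹ B1) ⊢ var 0 ∶ (sub (liftS wk₂) B) [ var 1 ]
  splitPair-snd {B = B} w eB = castTm (wk-as-sub-wk₂ B) (conv (var-I w here) (wkTyEq w eB))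

  splitPair-wf : ∀ {Γ A B A1 B1} → Γ ▹ A ⊢ B type → ⊢ (Γ ▹ A1 ▹ B1) → Γ ⊢ A1 ≐ A type → Γ ▹ A1 ⊢ B1 ≐ B type →
    (Γ ▹ A1 ▹ B1) ⊢ pair (wk (wk A)) (ren (liftR (λ k → suc (suc k))) B) (var 1) (var 0) ∶ sub wk₂ (`Σ A B)
  splitPair-wf {A = A} {B} dB w eA eB = castTmT (splitPair-as-sub A B) (Σ-I (subTy dB (slift (wk₂Sub w))) (splitPair-fst w eA) (splitPair-snd w eB))

  eqSub-splitTy : ∀ {Γ A B A' B'} → Γ ⊢ A type → Γ ▹ A ⊢ B type → Γ ⊢ A' type → Γ ▹ A' ⊢ B' type →
    Γ ⊢ A ≐ A' type → Γ ▹ A ⊢ B ≐ B' type →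
    EqSub (Γ ▹ A' ▹ B') (ext wk₂ (pair (wk (wk A)) (ren (liftR (λ k → suc (suc k))) B) (var 1) (var 0)))
                       (ext wk₂ (pair (wk (wk A')) (ren (liftR (λ k → suc (suc k))) B') (var 1) (var 0))) (Γ ▹ `Σ A B)
  eqSub-splitTy {A = A} {B} {A'} {B'} dA dB dA' dB' eA eB =
    eext (erefl (wfTy dA) g) upL upR eq (ty-refl (subTy (Σ-F dA dB) g))
    where
      w = ▹-wf dB'
      g = wk₂Sub w
      eB1 = ty-sym (convCtxTyEq dA' (ty-sym eA) eB)
      upL = splitPair-wf dB w (ty-sym eA) eB1
      upR = conv (splitPair-wf dB' w (ty-refl dA') (ty-refl dB')) (subTyEq (ty-sym (Σ-cong dA eA eB)) g)
      eq = castTmEq3 (splitPair-as-sub A B) (splitPair-as-sub A' B') refl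
             (pair-cong (subTyEq eA g) (subTyEq eB (slift g)) (tm-refl (splitPair-fst w (ty-sym eA))) (tm-refl (splitPair-snd w eB1)))

  eqSub-JreflTy : ∀ {Γ A A'} → Γ ⊢ A type → Γ ⊢ A' type → Γ ⊢ A ≐ A' type →
    EqSub (Γ ▹ A') (ext (ext (ext (λ k → var (suc k)) (var 0)) (var 0)) (rf (wk A) (var 0)))
                  (ext (ext (ext (λ k → var (suc k)) (var 0)) (var 0)) (rf (wk A') (var 0)))
                  (Γ ▹ A ▹ wk A ▹ `Id (wk (wk A)) (var 1) (var 0))
  eqSub-JreflTy {A = A} {A'} dA dA' eA =
    eqSub-ext₃ (erefl (wfTy dA) g) u u (tm-refl u) u u (tm-refl u) dw dw' ew (ty-refl (subTy dA g))
    where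
      w = ▹-wf dA'
      g = wkSub w
      vA : (_ ▹ A') ⊢ var 0 ∶ wk A
      vA = conv (var-I w here) (wkTyEq w (ty-sym eA))
      u = castTm (wk-as-sub A) vA
      dw = castTmT (cong (λ X → rf X (var 0)) (sym (wk-as-sub A))) (Id-I u)
      vh = var-I w here
      dw' = conv (Id-I vh) (castTyEq refl (cong (λ X → `Id X (var 0) (var 0)) (wk-as-sub A)) (Id-cong (wkTyEq w (ty-sym eA)) (tm-refl vh) (tm-refl vh)))
      ew = castTmEq (cong (λ X → `Id X (var 0) (var 0)) (wk-as-sub A)) (rf-cong (wkTyEq w eA) (tm-refl vA))

  eqSub-stepTy : ∀ {Γ C'} → Γ ▹ `ℕ ⊢ C' type → EqSub (Γ ▹ `ℕ ▹ C') (ext wk₂ (su (var 1))) (ext wk₂ (su (var 1))) (Γ ▹ `ℕ)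
  eqSub-stepTy dC' = eext (erefl (wf-init (wf-init w)) (wk₂Sub w)) u u (tm-refl u) (ty-refl (ℕ-F w))
    where
      w = ▹-wf dC'
      u = ℕ-I₁ (var-I w (there here))

  ctxConvSubJ : ∀ {Γ A A'} → Γ ⊢ A' type → Γ ⊢ A' ≐ A type →
    WfSub (Γ ▹ A' ▹ wk A' ▹ `Id (wk (wk A')) (var 1) (var 0)) (liftS (liftS (liftS var))) (Γ ▹ A ▹ wk A ▹ `Id (wk (wk A)) (var 1) (var 0))
  ctxConvSubJ {A = A} {A'} dA' eA' = sctx g2 dId' eqId
    where
      g1 = ctxConvSub dA' eA'
      w1 = ▹-wf dA'
      dwkA' = wkTy w1 dA'
      g2 = sctx g1 dwkA' (castTyEq refl (sym (sub-liftS-var (wk A))) (wkTyEq w1 eA'))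
      w2 = ▹-wf dwkA'
      vv1 = var-I w2 (there here)
      vv0 = var-I w2 here
      dId' = Id-F (wkTy w2 dwkA') vv1 vv0
      eqId = castTyEq refl (cong (λ X → `Id X (var 1) (var 0)) (sym (sub-liftS²-var (wk (wk A)))))
               (Id-cong (wkTyEq w2 (wkTyEq w1 eA')) (tm-refl vv1) (tm-refl vv0))

  tm-trans-sym : ∀ {Δ x y z A A'} → Δ ⊢ x ≐ y ∶ A → Δ ⊢ z ≐ y ∶ A' → Δ ⊢ A ≐ A' type → Δ ⊢ x ≐ z ∶ A
  tm-trans-sym a b eA = tm-trans a (tm-sym (tm-conv b (ty-sym eA)))

  ty-trans-sym : ∀ {Δ X Y Z} → Δ ⊢ X ≐ Y type → Δ ⊢ Z ≐ Y type → Δ ⊢ X ≐ Z type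
  ty-trans-sym a b = ty-trans a (ty-sym b)

  -- Presupposition needs functionality (the right-hand side of a congruence such as
  -- app-cong has type B[a'], to be converted to B[a]) and functionality needs
  -- presupposition, hence one mutual block.
  cong-subTy : ∀ {Γ Δ σ σ' A} → Γ ⊢ A type → EqSub Δ σ σ' Γ → Δ ⊢ sub σ A ≐ sub σ' A type
  cong-subTyEq : ∀ {Γ Δ σ σ' A B} → Γ ⊢ A ≐ B type → EqSub Δ σ σ' Γ → Δ ⊢ sub σ A ≐ sub σ' B type
  cong-subTm : ∀ {Γ Δ σ σ' t A} → Γ ⊢ t ∶ A → EqSub Δ σ σ' Γ → (Δ ⊢ sub σ t ≐ sub σ' t ∶ sub σ A) × (Δ ⊢ sub σ A ≐ sub σ' A type)
  cong-subTmEq : ∀ {Γ Δ σ σ' a b A} → Γ ⊢ a ≐ b ∶ A → EqSub Δ σ σ' Γ → (Δ ⊢ sub σ a ≐ sub σ' b ∶ sub σ A) × (Δ ⊢ sub σ A ≐ sub σ' A type)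
  presup-tm : ∀ {Γ t A} → Γ ⊢ t ∶ A → Γ ⊢ A type
  presup-tyEq : ∀ {Γ A B} → Γ ⊢ A ≐ B type → (Γ ⊢ A type) × (Γ ⊢ B type)
  presup-tmEq : ∀ {Γ a b A} → Γ ⊢ a ≐ b ∶ A → (Γ ⊢ a ∶ A) × (Γ ⊢ b ∶ A) × (Γ ⊢ A type)

  cong-subTy (ℕ-F w) e = ty-refl (ℕ-F (subWf w (eqSubˡ e)))
  cong-subTy (G-F w) e = ty-refl (G-F (subWf w (eqSubˡ e)))
  cong-subTy (Π-F dA dB) e = Π-cong (subTy dA (eqSubˡ e)) (cong-subTy dA e) (cong-subTy dB (eqSub-lift e (cong-subTy dA e)))
  cong-subTy (Σ-F dA dB) e = Σ-cong (subTy dA (eqSubˡ e)) (cong-subTy dA e) (cong-subTy dB (eqSub-lift e (cong-subTy dA e)))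
  cong-subTy (Id-F dA da db) e = Id-cong (cong-subTy dA e) (proj₁ (cong-subTm da e)) (proj₁ (cong-subTm db e))

  cong-subTyEq (ty-refl d) e = cong-subTy d e
  cong-subTyEq (ty-sym d) e = ty-sym (cong-subTyEq d (eqSub-sym e))
  cong-subTyEq (ty-trans d d') e = ty-trans (cong-subTyEq d e) (cong-subTyEq d' (eqSub-diagʳ e))
  cong-subTyEq (Π-cong dA eA eB) e = Π-cong (subTy dA (eqSubˡ e)) (cong-subTyEq eA e) (cong-subTyEq eB (eqSub-lift e (cong-subTy dA e)))
  cong-subTyEq (Σ-cong dA eA eB) e = Σ-cong (subTy dA (eqSubˡ e)) (cong-subTyEq eA e) (cong-subTyEq eB (eqSub-lift e (cong-subTy dA e)))
  cong-subTyEq (Id-cong eA ea eb) e = Id-cong (cong-subTyEq eA e) (proj₁ (cong-subTmEq ea e)) (proj₁ (cong-subTmEq eb e))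

  cong-subTm (var-I w x) e = eqSub-var (subWf w (eqSubˡ e)) e x
  cong-subTm (conv d eq) e with cong-subTm d e
  ... | h1 , h2 = tm-conv h1 (subTyEq eq (eqSubˡ e)) , ty-trans (ty-sym (subTyEq eq (eqSubˡ e))) (ty-trans h2 (subTyEq eq (eqSubʳ e)))
  cong-subTm (Π-I dA db) e with cong-subTm db (eqSub-lift e (cong-subTy dA e))
  ... | h1 , h2 = lam-cong (subTy dA (eqSubˡ e)) (cong-subTy dA e) h1 , Π-cong (subTy dA (eqSubˡ e)) (cong-subTy dA e) h2
  cong-subTm {σ = σ} {σ'} (Π-E {B = B} {a = a} dB df da) e with cong-subTm da e | cong-subTm df e
  ... | a1 , a2 | f1 , f2 =
    castTmEq (sym (sub-[] σ a B)) (app-cong a2 (cong-subTy dB (eqSub-lift e a2)) f1 a1) ,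
    castTyEq (sym (sub-single σ a B)) (sym (sub-single σ' a B)) (cong-subTy dB (eext e (subTm da (eqSubˡ e)) (subTm da (eqSubʳ e)) a1 a2))
  cong-subTm {σ = σ} (Σ-I {B = B} {a = a} dB da db) e with cong-subTm da e | cong-subTm db e
  ... | a1 , a2 | b1 , b2 =
    pair-cong a2 (cong-subTy dB (eqSub-lift e a2)) a1 (castTmEq (sub-[] σ a B) b1) ,
    Σ-cong (subTy (wf-last (wfTy dB)) (eqSubˡ e)) a2 (cong-subTy dB (eqSub-lift e a2))
  cong-subTm {σ = σ} {σ'} (Σ-E {A = A} {B = B} {C = C} {p = p} dC dd dp) e with cong-subTm dp e
  ... | p1 , p2 =
    castTmEq (sym (sub-[] σ p C)) (split-cong qA qB (cong-subTy dC (eqSub-lift e p2)) (castTmEq (sub-splitTy σ A B C) (proj₁ (cong-subTm dd eAB))) p1) ,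
    castTyEq (sym (sub-single σ p C)) (sym (sub-single σ' p C)) (cong-subTy dC (eext e (subTm dp (eqSubˡ e)) (subTm dp (eqSubʳ e)) p1 p2))
    where
      dB0 = wf-last (wfTm dd)
      dA0 = wf-last (wfTy dB0)
      sA = subTy dA0 (eqSubˡ e)
      qs = Σ-cong-inv sA p2
      qA = proj₁ qs
      qB = proj₂ qs
      eAB = eqSub-lift (eqSub-lift e qA) qB
  cong-subTm (Id-I da) e with cong-subTm da e
  ... | a1 , a2 = rf-cong a2 a1 , Id-cong a2 a1 a1
  cong-subTm {Δ = Δ} {σ = σ} {σ'} (Id-E {A = A} {C = C} {a = a} {b = b} {p = p} dA dC dd dp) e with cong-subTm dp e | Id-F-inv (presup-tm dp)
  ... | p1 , p2 | _ , da , db =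
    castTmEq (sym (sub-[,,] σ a b p C))
      (J-cong qA (castCtxTyEq (ctxEq Δ σ A) (cong-subTy dC (eqSub-lift₃ e sA qA))) (castTmEq (sub-JreflTy σ A C) (proj₁ (cong-subTm dd (eqSub-lift e qA))))
              (proj₁ (proj₂ inv)) (proj₂ (proj₂ inv)) p1) ,
    castTyEq (sym (sub-triple σ a b p C)) (sym (sub-triple σ' a b p C))
      (cong-subTy dC (eqSub-ext₃ e (subTm da L) (subTm da R) (proj₁ (proj₂ inv)) (subTm db L) (subTm db R) (proj₂ (proj₂ inv))
                       (subTm dp L) (subTm dp R) p1 qA))
    where
      L = eqSubˡ e
      R = eqSubʳ e
      inv = Id-cong-inv p2
      qA = cong-subTy dA e
      sA = subTy dA L
  cong-subTm (ℕ-I₀ w) e = tm-refl (ℕ-I₀ (subWf w (eqSubˡ e))) , ty-refl (ℕ-F (subWf w (eqSubˡ e)))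
  cong-subTm (ℕ-I₁ d) e with cong-subTm d e
  ... | h1 , h2 = su-cong h1 , h2
  cong-subTm {σ = σ} {σ'} (ℕ-E {C = C} {n = n} dC dz ds dn) e with cong-subTm dn e
  ... | n1 , n2 =
    castTmEq (sym (sub-[] σ n C))
      (natrec-cong qC (castTmEq (sub-[] σ ze C) (proj₁ (cong-subTm dz e))) (castTmEq (sub-stepTy σ C) (proj₁ (cong-subTm ds (eqSub-lift eN qC)))) n1) ,
    castTyEq (sym (sub-single σ n C)) (sym (sub-single σ' n C))
      (cong-subTy dC (eext e (subTm dn (eqSubˡ e)) (subTm dn (eqSubʳ e)) n1 (ty-refl (ℕ-F wΔ))))
    where
      wΔ = wfTm (subTm dn (eqSubˡ e))
      eN = eqSub-lift e (ty-refl (ℕ-F wΔ))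
      qC = cong-subTy dC eN
  cong-subTm {σ = σ} {σ'} (cell-I n α w) e =
    tm-refl (subTm (cell-I n α w) (eqSubˡ e)) ,
    castTyEq (sym (sub-cellTy σ n α)) (sym (sub-cellTy σ' n α)) (ty-refl (cellTy-wf (subWf w (eqSubˡ e)) n α))

  cong-subTmEq (tm-refl d) e = cong-subTm d e
  cong-subTmEq (tm-sym d) e with cong-subTmEq d (eqSub-sym e)
  ... | h1 , h2 = tm-sym (tm-conv h1 h2) , ty-sym h2
  cong-subTmEq (tm-trans d d') e with cong-subTmEq d e | cong-subTmEq d' (eqSub-diagʳ e)
  ... | h1 , h2 | k1 , k2 = tm-trans h1 (tm-conv k1 (ty-sym h2)) , h2
  cong-subTmEq (tm-conv d eq) e with cong-subTmEq d e
  ... | h1 , h2 = tm-conv h1 (subTyEq eq (eqSubˡ e)) , ty-trans (ty-sym (subTyEq eq (eqSubˡ e))) (ty-trans h2 (subTyEq eq (eqSubʳ e)))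
  cong-subTmEq (reflect d) e with cong-subTm d e
  ... | p1 , p2 with Id-cong-inv p2
  ... | qA , a1 , b1 = tm-trans a1 (tm-conv (reflect (subTm d (eqSubʳ e))) (ty-sym qA)) , qA
  cong-subTmEq {σ = σ} {σ'} (Π-β {B = B} {b = b} {a = a} dA db da) e with cong-subTm da e
  ... | a1 , a2 with cong-subTm db (eext e (subTm da (eqSubˡ e)) (subTm da (eqSubʳ e)) a1 a2)
  ... | b1 , b2 =
    tm-trans (subTmEq (Π-β dA db da) (eqSubˡ e)) (castTmEq3 (sym (sub-single σ a b)) (sym (sub-single σ' a b)) (sym (sub-single σ a B)) b1) ,
    castTyEq (sym (sub-single σ a B)) (sym (sub-single σ' a B)) b2
  cong-subTmEq {σ = σ} {σ'} (Σ-β {A = A} {B = B} {C = C} {d = d} {a = a} {b = b} dC dd dB da db) e with cong-subTm da e | cong-subTm db e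
  ... | a1 , a2 | b1 , b2 with cong-subTm dd e2
    where
      e2 = eext (eext e (subTm da (eqSubˡ e)) (subTm da (eqSubʳ e)) a1 a2)
                (castTm (sub-single σ a B) (subTm db (eqSubˡ e))) (castTm (sub-single σ' a B) (subTm db (eqSubʳ e)))
                (castTmEq (sub-single σ a B) b1) (castTyEq (sub-single σ a B) (sub-single σ' a B) b2)
  ... | d1 , d2 =
    tm-trans (subTmEq (Σ-β dC dd dB da db) (eqSubˡ e)) (castTmEq3 (sym (sub-double σ a b d)) (sym (sub-double σ' a b d)) (eqT σ) d1) ,
    castTyEq (eqT σ) (eqT σ') d2
    where
      eqT : ∀ (τ : Sub) → sub (ext (ext τ (sub τ a)) (sub τ b)) (splitTy A B C) ≡ sub τ (C [ pair A B a b ])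
      eqT τ = trans (splitTy-ext τ (sub τ a) (sub τ b) A B C) (sym (sub-single τ (pair A B a b) C))
  cong-subTmEq {σ = σ} {σ'} (Id-β {A = A} {C = C} {d = d} {a = a} dA dC dd da) e with cong-subTm da e
  ... | a1 , a2 with cong-subTm dd (eext e (subTm da (eqSubˡ e)) (subTm da (eqSubʳ e)) a1 a2)
  ... | d1 , d2 =
    tm-trans (subTmEq (Id-β dA dC dd da) (eqSubˡ e)) (castTmEq3 (sym (sub-single σ a d)) (sym (sub-single σ' a d)) (eqT σ) d1) ,
    castTyEq (eqT σ) (eqT σ') d2
    where
      eqT : ∀ (τ : Sub) → sub (ext τ (sub τ a)) (JreflTy A C) ≡ sub τ (_[_,_,_] C a a (rf A a))
      eqT τ = trans (JreflTy-ext τ (sub τ a) A C) (sym (sub-triple τ a a (rf A a) C))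
  cong-subTmEq (ℕ-β₀ dC dz ds) e with cong-subTm dz e
  ... | z1 , z2 = tm-trans (subTmEq (ℕ-β₀ dC dz ds) (eqSubˡ e)) z1 , z2
  cong-subTmEq {σ = σ} {σ'} (ℕ-β₁ {C = C} {z = z} {s = s} {n = n} dC dz ds dn) e with cong-subTm dn e
  ... | n1 , n2 with cong-subTm ds e2
    where
      wΔ = wfTm (subTm dn (eqSubˡ e))
      eN = eqSub-lift e (ty-refl (ℕ-F wΔ))
      qC = cong-subTy dC eN
      r1 = castTmEq (sym (sub-[] σ n C))
             (natrec-cong qC (castTmEq (sub-[] σ ze C) (proj₁ (cong-subTm dz e))) (castTmEq (sub-stepTy σ C) (proj₁ (cong-subTm ds (eqSub-lift eN qC)))) n1)
      en = eext e (subTm dn (eqSubˡ e)) (subTm dn (eqSubʳ e)) n1 (ty-refl (ℕ-F wΔ))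
      e2 = eext en (castTm (sub-single σ n C) (subTm (ℕ-E dC dz ds dn) (eqSubˡ e)))
                   (castTm (sub-single σ' n C) (subTm (ℕ-E dC dz ds dn) (eqSubʳ e)))
                   (castTmEq (sub-single σ n C) r1) (cong-subTy dC en)
  ... | singleSub , doubleSub =
    tm-trans (subTmEq (ℕ-β₁ dC dz ds dn) (eqSubˡ e))
             (castTmEq3 (sym (sub-double σ n (natrec C z s n) s)) (sym (sub-double σ' n (natrec C z s n) s)) (eqT σ) singleSub) ,
    castTyEq (eqT σ) (eqT σ') doubleSub
    where
      eqT : ∀ (τ : Sub) → sub (ext (ext τ (sub τ n)) (sub τ (natrec C z s n))) (stepTy C) ≡ sub τ (C [ su n ])
      eqT τ = trans (stepTy-ext τ (sub τ n) (sub τ (natrec C z s n)) C) (sym (sub-single τ (su n) C))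
  cong-subTmEq (lam-cong dA eA eb) e with cong-subTmEq eb (eqSub-lift e qA)
    where qA = ty-trans-sym (cong-subTyEq eA e) (cong-subTyEq eA (eqSub-diagʳ e))
  ... | b1 , b2 = lam-cong (subTy dA (eqSubˡ e)) (cong-subTyEq eA e) b1 , Π-cong (subTy dA (eqSubˡ e)) (ty-trans-sym (cong-subTyEq eA e) (cong-subTyEq eA (eqSub-diagʳ e))) b2
  cong-subTmEq {σ = σ} {σ'} (app-cong {B = B} {a = a} eA eB ef ea) e with cong-subTmEq ea e | cong-subTmEq ea (eqSub-diagʳ e) | cong-subTmEq ef e | presup-tmEq ea
  ... | a1 , a2 | k1 , k2 | f1 , f2 | da , _ , _ =
    castTmEq (sym (sub-[] σ a B)) (app-cong (cong-subTyEq eA e) (cong-subTyEq eB (eqSub-lift e a2)) f1 a1) ,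
    castTyEq (sym (sub-single σ a B)) (sym (sub-single σ' a B)) (ty-trans-sym X1 X2)
    where
      R = eqSubʳ e
      aa = tm-trans-sym a1 k1 a2
      X1 = cong-subTyEq eB (eext e (subTm da (eqSubˡ e)) (subTm da R) aa a2)
      X2 = cong-subTyEq eB (eext (eqSub-diagʳ e) (subTm da R) (subTm da R) (tm-refl (subTm da R)) (ty-trans (ty-sym a2) a2))
  cong-subTmEq {σ = σ} (pair-cong {B = B} {a = a} eA eB ea eb) e with cong-subTmEq ea e | cong-subTmEq eb e | presup-tyEq eA
  ... | a1 , a2 | b1 , b2 | dA , _ =
    pair-cong (cong-subTyEq eA e) (cong-subTyEq eB eL) a1 (castTmEq (sub-[] σ a B) b1) ,
    Σ-cong (subTy dA (eqSubˡ e)) a2 (ty-trans-sym (cong-subTyEq eB eL) (cong-subTyEq eB (eqSub-diagʳ eL)))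
    where eL = eqSub-lift e a2
  cong-subTmEq {σ = σ} {σ'} (split-cong {A = A} {B = B} {C = C} {p = p} eA eB eC ed ep) e with cong-subTmEq ep e | cong-subTmEq ep (eqSub-diagʳ e) | presup-tyEq eA | presup-tmEq ep
  ... | p1 , p2 | k1 , k2 | dA , _ | dp , _ , _ =
    castTmEq (sym (sub-[] σ p C))
      (split-cong (cong-subTyEq eA e) (cong-subTyEq eB e1) (cong-subTyEq eC (eqSub-lift e qΣ)) (castTmEq (sub-splitTy σ A B C) (proj₁ (cong-subTmEq ed (eqSub-lift e1 qB)))) p1) ,
    castTyEq (sym (sub-single σ p C)) (sym (sub-single σ' p C)) (ty-trans-sym X1 X2)
    where
      L = eqSubˡ e
      R = eqSubʳ e
      qA = ty-trans-sym (cong-subTyEq eA e) (cong-subTyEq eA (eqSub-diagʳ e))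
      e1 = eqSub-lift e qA
      qB = ty-trans-sym (cong-subTyEq eB e1) (cong-subTyEq eB (eqSub-diagʳ e1))
      qΣ = Σ-cong (subTy dA L) qA qB
      pp = tm-trans-sym p1 k1 p2
      X1 = cong-subTyEq eC (eext e (subTm dp L) (subTm dp R) pp p2)
      X2 = cong-subTyEq eC (eext (eqSub-diagʳ e) (subTm dp R) (subTm dp R) (tm-refl (subTm dp R)) (ty-trans (ty-sym p2) p2))
  cong-subTmEq (rf-cong eA ea) e with cong-subTmEq ea e | cong-subTmEq ea (eqSub-diagʳ e)
  ... | a1 , a2 | k1 , k2 = rf-cong (cong-subTyEq eA e) a1 , Id-cong a2 (tm-trans-sym a1 k1 a2) (tm-trans-sym a1 k1 a2)
  cong-subTmEq {Δ = Δ} {σ = σ} {σ'} (J-cong {A = A} {C = C} {a = a} {b = b} {p = p} eA eC ed ea eb ep) e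
    with cong-subTmEq ea e | cong-subTmEq ea (eqSub-diagʳ e) | cong-subTmEq eb e | cong-subTmEq eb (eqSub-diagʳ e) | cong-subTmEq ep e | cong-subTmEq ep (eqSub-diagʳ e) | presup-tyEq eA | presup-tmEq ea | presup-tmEq eb | presup-tmEq ep
  ... | a1 , a2 | ka , _ | b1 , _ | kb , _ | p1 , p2 | kp , _ | dA , _ | da , _ , _ | db , _ , _ | dp , _ , _ =
    castTmEq (sym (sub-[,,] σ a b p C))
      (J-cong (cong-subTyEq eA e) (castCtxTyEq (ctxEq Δ σ A) (cong-subTyEq eC (eqSub-lift₃ e sA qA))) (castTmEq (sub-JreflTy σ A C) (proj₁ (cong-subTmEq ed (eqSub-lift e qA))))
              a1 b1 p1) ,
    castTyEq (sym (sub-triple σ a b p C)) (sym (sub-triple σ' a b p C)) (ty-trans-sym X1 X2)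
    where
      L = eqSubˡ e
      R = eqSubʳ e
      qA = ty-trans-sym (cong-subTyEq eA e) (cong-subTyEq eA (eqSub-diagʳ e))
      sA = subTy dA L
      aa = tm-trans-sym a1 ka qA
      bb = tm-trans-sym b1 kb qA
      pp = tm-trans-sym p1 kp p2
      qA' = ty-trans (ty-sym qA) qA
      X1 = cong-subTyEq eC (eqSub-ext₃ e (subTm da L) (subTm da R) aa (subTm db L) (subTm db R) bb (subTm dp L) (subTm dp R) pp qA)
      X2 = cong-subTyEq eC (eqSub-ext₃ (eqSub-diagʳ e) (subTm da R) (subTm da R) (tm-refl (subTm da R)) (subTm db R) (subTm db R) (tm-refl (subTm db R))
                           (subTm dp R) (subTm dp R) (tm-refl (subTm dp R)) qA')
  cong-subTmEq (su-cong d) e with cong-subTmEq d e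
  ... | h1 , h2 = su-cong h1 , h2
  cong-subTmEq {σ = σ} {σ'} (natrec-cong {C = C} {n = n} eC ez es en) e with cong-subTmEq en e | cong-subTmEq en (eqSub-diagʳ e) | presup-tmEq en
  ... | n1 , n2 | k1 , k2 | dn , _ , _ =
    castTmEq (sym (sub-[] σ n C))
      (natrec-cong (cong-subTyEq eC eN) (castTmEq (sub-[] σ ze C) (proj₁ (cong-subTmEq ez e))) (castTmEq (sub-stepTy σ C) (proj₁ (cong-subTmEq es (eqSub-lift eN qC)))) n1) ,
    castTyEq (sym (sub-single σ n C)) (sym (sub-single σ' n C)) (ty-trans-sym X1 X2)
    where
      L = eqSubˡ e
      R = eqSubʳ e
      wΔ = wfTm (subTm dn L)
      ℕr = ty-refl (ℕ-F wΔ)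
      eN = eqSub-lift e ℕr
      qC = ty-trans-sym (cong-subTyEq eC eN) (cong-subTyEq eC (eqSub-diagʳ eN))
      X1 = cong-subTyEq eC (eext e (subTm dn L) (subTm dn R) (tm-trans-sym n1 k1 ℕr) ℕr)
      X2 = cong-subTyEq eC (eext (eqSub-diagʳ e) (subTm dn R) (subTm dn R) (tm-refl (subTm dn R)) ℕr)
  cong-subTmEq {σ = σ} {σ'} (cell-idc n α w) e =
    castTmEq3 refl (cong (λ X → rf X (cell n α)) (trans (sub-cellTy σ n α) (sym (sub-cellTy σ' n α)))) refl (subTmEq (cell-idc n α w) (eqSubˡ e)) ,
    castTyEq (sym (sub-cellTy σ (suc n) (idc α))) (sym (sub-cellTy σ' (suc n) (idc α))) (ty-refl (cellTy-wf (subWf w (eqSubˡ e)) (suc n) (idc α)))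

  presup-tm (var-I w x) = lookupTy w x
  presup-tm (conv d e) = proj₂ (presup-tyEq e)
  presup-tm (Π-I dA db) = Π-F dA (presup-tm db)
  presup-tm (Π-E dB df da) = subTy dB (singleSub da)
  presup-tm (Σ-I dB da db) = Σ-F (wf-last (wfTy dB)) dB
  presup-tm (Σ-E dC dd dp) = subTy dC (singleSub dp)
  presup-tm (Id-I da) = Id-F (presup-tm da) da da
  presup-tm (Id-E dA dC dd dp) with Id-F-inv (presup-tm dp)
  ... | _ , da , db = subTy dC (JSub da db dp)
  presup-tm (ℕ-I₀ w) = ℕ-F w
  presup-tm (ℕ-I₁ d) = ℕ-F (wfTm d)
  presup-tm (ℕ-E dC dz ds dn) = subTy dC (singleSub dn)
  presup-tm (cell-I n α w) = cellTy-wf w n α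

  presup-tyEq (ty-refl d) = d , d
  presup-tyEq (ty-sym d) with presup-tyEq d
  ... | x , y = y , x
  presup-tyEq (ty-trans d e) = proj₁ (presup-tyEq d) , proj₂ (presup-tyEq e)
  presup-tyEq (Π-cong dA eA eB) with presup-tyEq eA | presup-tyEq eB
  ... | _ , dA' | dB , dB' = Π-F dA dB , Π-F dA' (convCtxTy dA' (ty-sym eA) dB')
  presup-tyEq (Σ-cong dA eA eB) with presup-tyEq eA | presup-tyEq eB
  ... | _ , dA' | dB , dB' = Σ-F dA dB , Σ-F dA' (convCtxTy dA' (ty-sym eA) dB')
  presup-tyEq (Id-cong eA ea eb) with presup-tyEq eA | presup-tmEq ea | presup-tmEq eb
  ... | dA , dA' | a , a' , _ | b , b' , _ = Id-F dA a b , Id-F dA' (conv a' eA) (conv b' eA)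

  presup-tmEq (tm-refl d) = d , d , presup-tm d
  presup-tmEq (tm-sym d) with presup-tmEq d
  ... | x , y , t = y , x , t
  presup-tmEq (tm-trans d d') with presup-tmEq d | presup-tmEq d'
  ... | x , _ , t | _ , z , _ = x , z , t
  presup-tmEq (tm-conv d e) with presup-tmEq d
  ... | x , y , _ = conv x e , conv y e , proj₂ (presup-tyEq e)
  presup-tmEq (reflect d) with Id-F-inv (presup-tm d)
  ... | dA , da , db = da , db , dA
  presup-tmEq (Π-β dA db da) = Π-E (presup-tm db) (Π-I dA db) da , subTm db (singleSub da) , subTy (presup-tm db) (singleSub da)
  presup-tmEq (Σ-β {A = A} {B = B} {C = C} {a = a} {b = b} dC dd dB da db) =
    Σ-E dC dd (Σ-I dB da db) , castTm (splitTy-sub A B C a b) (subTm dd (doubleSub da db)) , subTy dC (singleSub (Σ-I dB da db))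
  presup-tmEq (Id-β {A = A} {C = C} {a = a} dA dC dd da) =
    Id-E dA dC dd (Id-I da) , castTm (JreflTy-sub A C a) (subTm dd (singleSub da)) , subTy dC (JSub da da (Id-I da))
  presup-tmEq (ℕ-β₀ dC dz ds) = ℕ-E dC dz ds (ℕ-I₀ (wfTm dz)) , dz , subTy dC (singleSub (ℕ-I₀ (wfTm dz)))
  presup-tmEq (ℕ-β₁ {C = C} {z = z} {s = s} {n = n} dC dz ds dn) =
    ℕ-E dC dz ds (ℕ-I₁ dn) , castTm (stepTy-sub C n (natrec C z s n)) (subTm ds (doubleSub dn (ℕ-E dC dz ds dn))) , subTy dC (singleSub (ℕ-I₁ dn))
  presup-tmEq (lam-cong dA eA eb) with presup-tyEq eA | presup-tmEq eb
  ... | _ , dA' | x , y , tB =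
    Π-I dA x ,
    conv (Π-I dA' (convCtxTm dA' (ty-sym eA) y)) (Π-cong dA' (ty-sym eA) (ty-refl (convCtxTy dA' (ty-sym eA) tB))) ,
    Π-F dA tB
  presup-tmEq (app-cong eA eB ef ea) with presup-tyEq eA | presup-tyEq eB | presup-tmEq ef | presup-tmEq ea
  ... | dA , dA' | dB , dB'0 | df , df' , _ | da , da' , _ =
    Π-E dB df da ,
    conv (Π-E dB' (conv df' (Π-cong dA eA eB)) (conv da' eA)) (ty-sym (cong-subTyEq eB (eqSub-single dA da da' ea))) ,
    subTy dB (singleSub da)
    where dB' = convCtxTy dA' (ty-sym eA) dB'0
  presup-tmEq (pair-cong eA eB ea eb) with presup-tyEq eA | presup-tyEq eB | presup-tmEq ea | presup-tmEq eb
  ... | dA , dA' | dB , dB'0 | da , da' , _ | db , db' , _ =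
    Σ-I dB da db ,
    conv (Σ-I (convCtxTy dA' (ty-sym eA) dB'0) (conv da' eA) (conv db' (cong-subTyEq eB (eqSub-single dA da da' ea)))) (ty-sym (Σ-cong dA eA eB)) ,
    Σ-F dA dB
  presup-tmEq (split-cong {A = A} {B = B} {C = C} {d' = d'} eA eB eC ed ep) with presup-tyEq eA | presup-tyEq eB | presup-tyEq eC | presup-tmEq ed | presup-tmEq ep
  ... | dA , dA' | dB , dB'0 | dC , dC'0 | dd , dd'0 , _ | dp , dp' , _ =
    Σ-E dC dd dp ,
    conv (Σ-E dC' d'c (conv dp' ΣEq)) (ty-sym (cong-subTyEq eC (eqSub-single (Σ-F dA dB) dp dp' ep))) ,
    subTy dC (singleSub dp)
    where
      dB' = convCtxTy dA' (ty-sym eA) dB'0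
      ΣEq = Σ-cong dA eA eB
      dC' = convCtxTy (Σ-F dA' dB') (ty-sym ΣEq) dC'0
      g2 = sctx (ctxConvSub dA' (ty-sym eA)) dB' (castTyEq refl (sym (sub-liftS-var B)) (ty-sym (convCtxTyEq dA' (ty-sym eA) eB)))
      d'1 = castTmT (sub-liftS²-var d') (castTm (sub-liftS²-var (splitTy A B C)) (subTm dd'0 g2))
      d'c = conv d'1 (cong-subTyEq eC (eqSub-splitTy dA dB dA' dB' eA eB))
  presup-tmEq (rf-cong eA ea) with presup-tyEq eA | presup-tmEq ea
  ... | dA , dA' | da , da' , _ =
    Id-I da ,
    conv (Id-I (conv da' eA)) (Id-cong (ty-sym eA) (tm-conv (tm-sym ea) eA) (tm-conv (tm-sym ea) eA)) ,
    Id-F dA da da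
  presup-tmEq (J-cong {A = A} {C = C} {C' = C'} {d' = d'} eA eC ed ea eb ep) with presup-tyEq eA | presup-tyEq eC | presup-tmEq ed | presup-tmEq ea | presup-tmEq eb | presup-tmEq ep
  ... | dA , dA' | dC , dC'0 | dd , dd'0 , _ | da , da' , _ | db , db' , _ | dp , dp' , _ =
    Id-E dA dC dd dp ,
    conv (Id-E dA' dC' d'c (conv dp' (Id-cong eA ea eb)))
         (ty-sym (cong-subTyEq eC (eqSub-ext₃ (erefl w (idSub w)) (cA da) (cA da') (castTmEq (sym (sub-var A)) ea)
                                              (cA db) (cA db') (castTmEq (sym (sub-var A)) eb)
                                              (castTm (cong (λ X → `Id X _ _) (sym (sub-var A))) dp)
                                              (castTm (cong (λ X → `Id X _ _) (sym (sub-var A))) (conv dp' (Id-cong (ty-refl dA) ea eb)))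
                                              (castTmEq (cong (λ X → `Id X _ _) (sym (sub-var A))) ep)
                                              (ty-refl (castTy (sym (sub-var A)) dA))))) ,
    subTy dC (JSub da db dp)
    where
      w = wfTy dA
      cA : ∀ {x} → _ ⊢ x ∶ A → _ ⊢ x ∶ sub var A
      cA d = castTm (sym (sub-var A)) d
      dC' = castTy (sub-liftS³-var C') (subTy dC'0 (ctxConvSubJ dA' (ty-sym eA)))
      d'c = conv (convCtxTm dA' (ty-sym eA) dd'0) (cong-subTyEq eC (eqSub-JreflTy dA dA' eA))
  presup-tmEq (su-cong d) with presup-tmEq d
  ... | x , y , _ = ℕ-I₁ x , ℕ-I₁ y , ℕ-F (wfTm x)
  presup-tmEq (natrec-cong {C = C} eC ez es en) with presup-tyEq eC | presup-tmEq ez | presup-tmEq es | presup-tmEq en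
  ... | dC , dC' | dz , dz' , _ | ds , ds' , _ | dn , dn' , _ =
    ℕ-E dC dz ds dn ,
    conv (ℕ-E dC' z'c s'c dn') (ty-sym (cong-subTyEq eC (eqSub-single dN dn dn' en))) ,
    subTy dC (singleSub dn)
    where
      w = wfTm dn
      dN = ℕ-F w
      z'c = conv dz' (cong-subTyEq eC (eqSub-single dN (ℕ-I₀ w) (ℕ-I₀ w) (tm-refl (ℕ-I₀ w))))
      s'c = conv (convCtxTm dC' (ty-sym eC) ds') (cong-subTyEq eC (eqSub-stepTy dC'))
  presup-tmEq (cell-idc n α w) = cell-I (suc n) (idc α) w , castTm (cellTy-idc n α) (Id-I (cell-I n α w)) , cellTy-wf w (suc n) (idc α)

  -- J with motive C x y q := Id (Id A x y) q (r x), which is well formed only because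
  -- reflection turns q : Id A x y into x ≐ y.
  UIP : ∀ {Γ A a b p} → Γ ⊢ p ∶ `Id A a b → Γ ⊢ p ≐ rf A a ∶ `Id A a b
  UIP {Γ} {A} {a} {b} {p} dp = reflect (castTm eqC (Id-E dA dC dd dp))
    where
      dA = proj₁ (Id-F-inv (presup-tm dp))
      A3 = wk (wk (wk A))
      C : Tm
      C = `Id (`Id A3 (var 2) (var 1)) (var 0) (rf A3 (var 2))
      w1 = ▹-wf dA
      dwA = wkTy w1 dA
      w2 = ▹-wf dwA
      v1' = var-I w2 (there here)
      v0' = var-I w2 here
      dIdT = Id-F (wkTy w2 dwA) v1' v0'
      w3 = ▹-wf dIdT
      dA3 = wkTy w3 (wkTy w2 dwA)
      v2 = var-I w3 (there (there here))
      v1 = var-I w3 (there here)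
      v0 = var-I w3 here
      dC : (Γ ▹ A ▹ wk A ▹ `Id (wk (wk A)) (var 1) (var 0)) ⊢ C type
      dC = Id-F (Id-F dA3 v2 v1) v0 (conv (Id-I v2) (Id-cong (ty-refl dA3) (tm-refl v2) (reflect v0)))
      eJ : sub (ext (ext (ext (λ k → var (suc k)) (var 0)) (var 0)) (rf (wk A) (var 0))) A3 ≡ wk A
      eJ = trans (wk³-ext³ _ _ _ _ A) (sym (wk-as-sub A))
      vA = var-I w1 here
      dd : (Γ ▹ A) ⊢ rf (`Id (wk A) (var 0) (var 0)) (rf (wk A) (var 0)) ∶ JreflTy A C
      dd = castTm (cong (λ X → `Id (`Id X (var 0) (var 0)) (rf (wk A) (var 0)) (rf X (var 0))) (sym eJ)) (Id-I (Id-I vA))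
      eC : sub (ext (ext (ext var a) b) p) A3 ≡ A
      eC = trans (wk³-ext³ var a b p A) (sub-var A)
      eqC : _[_,_,_] C a b p ≡ `Id (`Id A a b) p (rf A a)
      eqC = cong (λ X → `Id (`Id X a b) p (rf X a)) eC

  rf-≐ : ∀ {Γ A a b} → Γ ⊢ a ≐ b ∶ A → Γ ⊢ rf A a ∶ `Id A a b
  rf-≐ e = let da , _ , dA = presup-tmEq e in conv (Id-I da) (Id-cong (ty-refl dA) (tm-refl da) e)

  -- Reducibility of closed terms

  numeral : ℕ → Tm
  numeral zero = ze
  numeral (suc n) = su (numeral n)

  numeral-ℕ : ∀ n → ε ⊢ numeral n ∶ `ℕ
  numeral-ℕ zero = ℕ-I₀ ε-wf
  numeral-ℕ (suc n) = ℕ-I₁ (numeral-ℕ n)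

  -- Red A ρ t: the type A is open and ρ closes it, so reducibility is defined by
  -- recursion on the raw syntax of A; Red-sub lets the environment absorb substitutions.
  Red : Tm → Sub → Tm → Set
  Can : Tm → Sub → Tm → Set
  Red A ρ t = (ε ⊢ t ∶ sub ρ A) × Can A ρ t
  Can (`Π A B) ρ f = ∀ a → Red A ρ a → Σ[ y ∈ Tm ] (Red B (ext ρ a) y × (ε ⊢ app (sub ρ A) (sub (liftS ρ) B) f a ≐ y ∶ sub (ext ρ a) B))
  Can (`Σ A B) ρ p = Σ[ a ∈ Tm ] Σ[ b ∈ Tm ] (Red A ρ a × Red B (ext ρ a) b × (ε ⊢ p ≐ pair (sub ρ A) (sub (liftS ρ) B) a b ∶ sub ρ (`Σ A B)))
  Can (`Id A a b) ρ p = Σ[ u ∈ Tm ] (Red A ρ u × (ε ⊢ u ≐ sub ρ a ∶ sub ρ A))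
  Can `ℕ ρ t = Σ[ n ∈ ℕ ] (ε ⊢ t ≐ numeral n ∶ `ℕ)
  Can `G ρ t = Σ[ a ∈ Cell 0 ] (ε ⊢ t ≐ cell 0 a ∶ `G)
  Can _ ρ t = ⊥

  Red-≐ : ∀ {Γ A} → Γ ⊢ A type → ∀ ρ {t t'} → Red A ρ t → ε ⊢ t ≐ t' ∶ sub ρ A → ε ⊢ t' ∶ sub ρ A → Red A ρ t'
  Red-≐ (ℕ-F _) ρ (_ , n , eq) e ty' = ty' , n , tm-trans (tm-sym e) eq
  Red-≐ (G-F _) ρ (_ , a , eq) e ty' = ty' , a , tm-trans (tm-sym e) eq
  Red-≐ (Π-F {B = B} _ _) ρ (ty , cl) e ty' = ty' , λ a Ra →
    let y , Ry , eq = cl a Ra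
        dA , dB = Π-F-inv (presup-tm ty)
    in y , Ry , tm-trans (castTmEq (lift-ext ρ a B) (app-cong (ty-refl dA) (ty-refl dB) (tm-sym e) (tm-refl (proj₁ Ra)))) eq
  Red-≐ (Σ-F _ _) ρ (_ , a , b , Ra , Rb , peq) e ty' = ty' , a , b , Ra , Rb , tm-trans (tm-sym e) peq
  Red-≐ (Id-F _ _ _) ρ (_ , cl) e ty' = ty' , cl

  Red-sub : ∀ {Γ A} → Γ ⊢ A type → ∀ {τ ρ θ : Sub} → (∀ k → sub ρ (τ k) ≡ θ k) → ∀ t
          → (Red (sub τ A) ρ t → Red A θ t) × (Red A θ t → Red (sub τ A) ρ t)
  Red-sub (ℕ-F _) e t = (λ r → r) , (λ r → r)
  Red-sub (G-F _) e t = (λ r → r) , (λ r → r)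
  Red-sub (Π-F {A = A} {B = B} dA dB) {τ} {ρ} {θ} e t =
    (λ { (ty , cl) → castTm (sub-sub e (`Π A B)) ty , λ a Ra →
           let y , Ry , eq = cl a (proj₂ (Red-sub dA e a) Ra)
           in y , proj₁ (Red-sub dB (eB a) y) Ry , castTmEq3 (eapp a) refl (sub-sub (eB a) B) eq }) ,
    (λ { (ty , cl) → castTm (sym (sub-sub e (`Π A B))) ty , λ a Ra →
           let y , Ry , eq = cl a (proj₁ (Red-sub dA e a) Ra)
           in y , proj₂ (Red-sub dB (eB a) y) Ry , castTmEq3 (sym (eapp a)) refl (sym (sub-sub (eB a) B)) eq })
    where
      eB : ∀ a k → sub (ext ρ a) (liftS τ k) ≡ ext θ a k
      eB a zero = refl
      eB a (suc k) = trans (sub-ext-wk ρ a (τ k)) (e k)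
      eapp : ∀ a → app (sub ρ (sub τ A)) (sub (liftS ρ) (sub (liftS τ) B)) t a ≡ app (sub θ A) (sub (liftS θ) B) t a
      eapp a = cong₂ (λ X Y → app X Y t a) (sub-sub e A) (sub-sub (ss-lift e) B)
  Red-sub (Σ-F {A = A} {B = B} dA dB) {τ} {ρ} {θ} e t =
    (λ { (ty , a , b , Ra , Rb , peq) → castTm (sub-sub e (`Σ A B)) ty ,
          a , b , proj₁ (Red-sub dA e a) Ra , proj₁ (Red-sub dB (eB a) b) Rb , castTmEq3 refl (ep a b) (sub-sub e (`Σ A B)) peq }) ,
    (λ { (ty , a , b , Ra , Rb , peq) → castTm (sym (sub-sub e (`Σ A B))) ty ,
          a , b , proj₂ (Red-sub dA e a) Ra , proj₂ (Red-sub dB (eB a) b) Rb , castTmEq3 refl (sym (ep a b)) (sym (sub-sub e (`Σ A B))) peq })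
    where
      eB : ∀ a k → sub (ext ρ a) (liftS τ k) ≡ ext θ a k
      eB a zero = refl
      eB a (suc k) = trans (sub-ext-wk ρ a (τ k)) (e k)
      ep : ∀ a b → pair (sub ρ (sub τ A)) (sub (liftS ρ) (sub (liftS τ) B)) a b ≡ pair (sub θ A) (sub (liftS θ) B) a b
      ep a b = cong₂ (λ X Y → pair X Y a b) (sub-sub e A) (sub-sub (ss-lift e) B)
  Red-sub (Id-F {A = A} {a = a} {b = b} dA da db) e t =
    (λ { (ty , u , Ru , ueq) → castTm (sub-sub e (`Id A a b)) ty ,
          u , proj₁ (Red-sub dA e u) Ru , castTmEq3 refl (sub-sub e a) (sub-sub e A) ueq }) ,
    (λ { (ty , u , Ru , ueq) → castTm (sym (sub-sub e (`Id A a b))) ty ,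
          u , proj₂ (Red-sub dA e u) Ru , castTmEq3 refl (sym (sub-sub e a)) (sym (sub-sub e A)) ueq })

  RedEnv : Ctx → Sub → Set
  RedEnv Γ σ = ∀ {k T} → Γ ∋ k ⦂ T → Red T σ (σ k)

  redEnv-wfSub : ∀ {Γ σ} → RedEnv Γ σ → WfSub ε σ Γ
  redEnv-wfSub g = sbase ε-wf (λ x → proj₁ (g x))

  Red-wk : ∀ {Γ T σ a t} → Γ ⊢ T type → Red T σ t → Red (wk T) (ext σ a) t
  Red-wk {T = T} {σ} {a} {t} dT r =
    subst (λ X → Red X (ext σ a) t) (sym (wk-as-sub T)) (proj₂ (Red-sub dT {ρ = ext σ a} {θ = σ} (λ _ → refl) t) r)

  redEnv-ext : ∀ {Γ σ A a} → ⊢ Γ ▹ A → RedEnv Γ σ → Red A σ a → RedEnv (Γ ▹ A) (ext σ a)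
  redEnv-ext w g Ra here = Red-wk (wf-last w) Ra
  redEnv-ext w g Ra (there x) = Red-wk (lookupTy (wf-init w) x) (g x)

  redEnv-ε : RedEnv ε var
  redEnv-ε ()

  Red-≐type : ∀ {Γ A B σ} → Γ ⊢ A ≐ B type → RedEnv Γ σ → ∀ t → (Red A σ t → Red B σ t) × (Red B σ t → Red A σ t)
  Red-≐type (ty-refl d) g t = (λ r → r) , (λ r → r)
  Red-≐type (ty-sym d) g t = proj₂ (Red-≐type d g t) , proj₁ (Red-≐type d g t)
  Red-≐type (ty-trans d d') g t =
    (λ r → proj₁ (Red-≐type d' g t) (proj₁ (Red-≐type d g t) r)) , (λ r → proj₂ (Red-≐type d g t) (proj₂ (Red-≐type d' g t) r))
  Red-≐type {Γ} {σ = σ} (Π-cong {A = A} {A'} {B} {B'} dA eA eB) g t =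
    (λ { (ty , cl) → conv ty ΠE , λ a Ra' →
           let Ra = proj₂ (Red-≐type eA g a) Ra'
               y , Ry , eq = cl a Ra
           in y , proj₁ (Red-≐type eB (g▹ Ra) y) Ry , tm-conv (tm-trans (tm-sym (appEq (proj₁ Ra) ty)) eq) (BEq (proj₁ Ra)) }) ,
    (λ { (ty , cl) → conv ty (ty-sym ΠE) , λ a Ra →
           let y , Ry , eq = cl a (proj₁ (Red-≐type eA g a) Ra)
           in y , proj₂ (Red-≐type eB (g▹ Ra) y) Ry ,
              tm-trans (appEq (proj₁ Ra) (conv ty (ty-sym ΠE))) (tm-conv eq (ty-sym (BEq (proj₁ Ra)))) })
    where
      S = redEnv-wfSub g
      ΠE = subTyEq (Π-cong dA eA eB) S
      g▹ : ∀ {a} → Red A σ a → RedEnv (Γ ▹ A) (ext σ a)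
      g▹ = redEnv-ext (▹-wf dA) g
      appEq : ∀ {a} → ε ⊢ a ∶ sub σ A → ε ⊢ t ∶ sub σ (`Π A B) →
              ε ⊢ app (sub σ A) (sub (liftS σ) B) t a ≐ app (sub σ A') (sub (liftS σ) B') t a ∶ sub (ext σ a) B
      appEq {a} da dt = castTmEq (lift-ext σ a B) (app-cong (subTyEq eA S) (subTyEq eB (slift S)) (tm-refl dt) (tm-refl da))
      BEq : ∀ {a} → ε ⊢ a ∶ sub σ A → ε ⊢ sub (ext σ a) B ≐ sub (ext σ a) B' type
      BEq da = subTyEq eB (sext S da)
  Red-≐type {Γ} {σ = σ} (Σ-cong {A = A} {A'} {B} {B'} dA eA eB) g t =
    (λ { (ty , a , b , Ra , Rb , peq) →
          conv ty ΣE , a , b , proj₁ (Red-≐type eA g a) Ra , proj₁ (Red-≐type eB (g▹ Ra) b) Rb ,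
          tm-conv (tm-trans peq (pEq (proj₁ Ra) (proj₁ Rb))) ΣE }) ,
    (λ { (ty , a , b , Ra' , Rb' , peq) →
          let Ra = proj₂ (Red-≐type eA g a) Ra'
              Rb = proj₂ (Red-≐type eB (g▹ Ra) b) Rb'
          in conv ty (ty-sym ΣE) , a , b , Ra , Rb , tm-trans (tm-conv peq (ty-sym ΣE)) (tm-sym (pEq (proj₁ Ra) (proj₁ Rb))) })
    where
      S = redEnv-wfSub g
      ΣE = subTyEq (Σ-cong dA eA eB) S
      g▹ : ∀ {a} → Red A σ a → RedEnv (Γ ▹ A) (ext σ a)
      g▹ = redEnv-ext (▹-wf dA) g
      pEq : ∀ {a b} → ε ⊢ a ∶ sub σ A → ε ⊢ b ∶ sub (ext σ a) B →
            ε ⊢ pair (sub σ A) (sub (liftS σ) B) a b ≐ pair (sub σ A') (sub (liftS σ) B') a b ∶ sub σ (`Σ A B)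
      pEq {a} da db = pair-cong (subTyEq eA S) (subTyEq eB (slift S)) (tm-refl da) (tm-refl (castTm (sym (lift-ext σ a B)) db))
  Red-≐type (Id-cong eA ea eb) g t =
    (λ { (ty , u , Ru , ueq) → conv ty IE , u , proj₁ (Red-≐type eA g u) Ru , tm-conv (tm-trans ueq (subTmEq ea S)) (subTyEq eA S) }) ,
    (λ { (ty , u , Ru , ueq) → conv ty (ty-sym IE) , u , proj₂ (Red-≐type eA g u) Ru ,
                               tm-trans (tm-conv ueq (ty-sym (subTyEq eA S))) (tm-sym (subTmEq ea S)) })
    where
      S = redEnv-wfSub g
      IE = subTyEq (Id-cong eA ea eb) S

  Red-≐env : ∀ {Γ C ρ1 ρ2 t} → Γ ⊢ C type → ε ⊢ sub ρ1 C ≐ sub ρ2 C type → Red C ρ1 t → Red C ρ2 t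
  Red-≐env {ρ1 = ρ1} {ρ2} {t} dC e r =
    proj₁ (Red-sub dC {ρ2} {var} (λ k → sub-var (ρ2 k)) t)
      (proj₁ (Red-≐type e redEnv-ε t) (proj₂ (Red-sub dC {ρ1} {var} (λ k → sub-var (ρ1 k)) t) r))

  Red-cell : ∀ (σ : Sub) n α → Red (cellTy n α) σ (cell n α)
  Can-cell : ∀ (σ : Sub) n α → Can (cellTy n α) σ (cell n α)
  Red-cell σ n α = castTm (sym (sub-cellTy σ n α)) (cell-I n α ε-wf) , Can-cell σ n α
  Can-cell σ zero α = α , tm-refl (cell-I 0 α ε-wf)
  Can-cell σ (suc m) α = cell m (src α) , Red-cell σ m (src α) , tm-refl (castTm (sym (sub-cellTy σ m (src α))) (cell-I m (src α) ε-wf))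

  Red-numeral : ∀ (σ : Sub) m → Red `ℕ σ (numeral m)
  Red-numeral σ m = numeral-ℕ m , (m , tm-refl (numeral-ℕ m))

  fundamental : ∀ {Γ t A σ} → Γ ⊢ t ∶ A → RedEnv Γ σ → Red A σ (sub σ t)
  fundamental (var-I w x) g = g x
  fundamental (conv d e) g = proj₁ (Red-≐type e g _) (fundamental d g)
  fundamental {σ = σ} (Π-I {A = A} {B = B} {b = b} dA db) g =
    subTm (Π-I dA db) S ,
    λ a Ra → sub (ext σ a) b , fundamental db (redEnv-ext (▹-wf dA) g Ra) ,
             castTmEq3 refl (lift-ext σ a b) (lift-ext σ a B) (Π-β (subTy dA S) (subTm db (slift S)) (proj₁ Ra))
    where S = redEnv-wfSub g
  fundamental {σ = σ} (Π-E {B = B} {a = a} dB df da) g with fundamental df g | fundamental da g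
  ... | Rf | Ra with proj₂ Rf (sub σ a) Ra
  ... | y , Ry , eq =
    proj₂ (Red-sub dB (ext-var σ a) _)
      (Red-≐ dB (ext σ (sub σ a)) Ry (tm-sym eq)
           (castTm (lift-ext σ (sub σ a) B) (Π-E (subTy dB (slift (redEnv-wfSub g))) (proj₁ Rf) (proj₁ Ra))))
  fundamental {σ = σ} (Σ-I {a = a} {b = b} dB da db) g =
    subTm (Σ-I dB da db) (redEnv-wfSub g) ,
    (sub σ a , sub σ b , fundamental da g , proj₁ (Red-sub dB (ext-var σ a) _) (fundamental db g) , tm-refl (subTm (Σ-I dB da db) (redEnv-wfSub g)))
  fundamental {σ = σ} (Σ-E {A = A} {B = B} {C = C} {d = d} {p = p} dC dd dp) g with fundamental dp g
  ... | tp , (a , b , Ra , Rb , peq) =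
    proj₂ (Red-sub dC (ext-var σ p) _) (Red-≐ dC (ext σ (sub σ p)) RC (tm-sym full) typing)
    where
      S = redEnv-wfSub g
      dB0 = wf-last (wfTm dd)
      dA0 = wf-last (wfTy dB0)
      pr = pair (sub σ A) (sub (liftS σ) B) a b
      Rd = fundamental dd (redEnv-ext (wfTm dd) (redEnv-ext (wf-init (wfTm dd)) g Ra) Rb)
      RC0 = proj₁ (Red-sub dC (splitTy-pt σ a b A B) _) Rd
      wΓ = wf-init (wfTy dC)
      dpr = proj₁ (proj₂ (presup-tmEq peq))
      CE = cong-subTy dC (eext (erefl wΓ S) dpr tp (tm-sym peq) (ty-refl (presup-tm tp)))
      RC = Red-≐env dC CE RC0
      sC = subTy dC (slift S)
      sd = castTm (sub-splitTy σ A B C) (subTm dd (slift (slift S)))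
      sB = subTy dB0 (slift S)
      sA = subTy dA0 S
      e1 = split-cong (ty-refl sA) (ty-refl sB) (ty-refl sC) (tm-refl sd) peq
      e2 = Σ-β sC sd sB (proj₁ Ra) (castTm (sym (lift-ext σ a B)) (proj₁ Rb))
      full = tm-trans (castTmEq (lift-ext σ (sub σ p) C) e1) (tm-conv (castTmEq3 refl (lift2-ext σ a b d) (lift-ext σ pr C) e2) CE)
      typing = castTm (sub-single σ p C) (subTm (Σ-E dC dd dp) S)
  fundamental {σ = σ} (Id-I {a = a} da) g = subTm (Id-I da) (redEnv-wfSub g) , (sub σ a , fundamental da g , tm-refl (subTm da (redEnv-wfSub g)))
  fundamental {σ = σ} (Id-E {A = A} {C = C} {d = d} {a = a} {b = b} {p = p} dA dC dd dp) g with fundamental dp g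
  ... | tp , (u , Ru , ueq) =
    proj₂ (Red-sub dC (ext³-var σ a b p) _) (Red-≐ dC env2 RC (tm-sym full) typing)
    where
      S = redEnv-wfSub g
      sA = subTy dA S
      tu = proj₁ Ru
      ta = proj₁ (proj₂ (Id-F-inv (presup-tm tp)))
      tb = proj₂ (proj₂ (Id-F-inv (presup-tm tp)))
      ab = reflect tp
      ub = tm-trans ueq ab
      pu = tm-trans (UIP tp) (tm-conv (rf-cong (ty-refl sA) (tm-sym ueq)) (Id-cong (ty-refl sA) (tm-refl ta) ab))
      env2 = ext (ext (ext σ (sub σ a)) (sub σ b)) (sub σ p)
      Rd = fundamental dd (redEnv-ext (wfTm dd) g Ru)
      RC0 = proj₁ (Red-sub dC (JreflTy-pt σ u A) _) Rd
      rfp = tm-conv (tm-sym pu) (Id-cong (ty-refl sA) (tm-sym ueq) (tm-sym ub))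
      CE = cong-subTy dC (eqSub-ext₃ (erefl (wfTy dA) S) tu ta ueq tu tb ub (Id-I tu) tp rfp (ty-refl sA))
      RC = Red-≐env dC CE RC0
      sC = castCtxTy (ctxEq ε σ A) (subTy dC (slift (slift (slift S))))
      sd = castTm (sub-JreflTy σ A C) (subTm dd (slift S))
      e1 = J-cong (ty-refl sA) (ty-refl sC) (tm-refl sd) (tm-sym ueq) (tm-sym ub) pu
      e2 = Id-β sA sC sd tu
      full = tm-trans (castTmEq (lift3-ext σ (sub σ a) (sub σ b) (sub σ p) C) e1)
                      (tm-conv (castTmEq3 refl (lift-ext σ u d) (lift3-ext σ u u (rf (sub σ A) u) C) e2) CE)
      typing = castTm (sub-triple σ a b p C) (subTm (Id-E dA dC dd dp) S)
  fundamental (ℕ-I₀ w) g = ℕ-I₀ ε-wf , (0 , tm-refl (ℕ-I₀ ε-wf))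
  fundamental (ℕ-I₁ d) g with fundamental d g
  ... | ty , (n , eq) = ℕ-I₁ ty , (suc n , su-cong eq)
  fundamental {σ = σ} (ℕ-E {C = C} {z = z} {s = s} {n = n} dC dz ds dn) g with fundamental dn g
  ... | tn , (k , neq) =
    proj₂ (Red-sub dC (ext-var σ n) _) (Red-≐ dC (ext σ (sub σ n)) RCk eqk typing)
    where
      S = redEnv-wfSub g
      sC = subTy dC (slift S)
      sz = castTm (sub-[] σ ze C) (subTm dz S)
      ss = castTm (sub-stepTy σ C) (subTm ds (slift (slift S)))
      NR : ℕ → Tm
      NR m = natrec (sub (liftS σ) C) (sub σ z) (sub (liftS (liftS σ)) s) (numeral m)
      tNR : ∀ m → ε ⊢ NR m ∶ sub (ext σ (numeral m)) C
      tNR m = castTm (lift-ext σ (numeral m) C) (ℕ-E sC sz ss (numeral-ℕ m))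
      Q : ∀ m → Red C (ext σ (numeral m)) (NR m)
      Q zero = Red-≐ dC (ext σ ze) (proj₁ (Red-sub dC (ext-var σ ze) (sub σ z)) (fundamental dz g))
                   (tm-sym (castTmEq (lift-ext σ ze C) (ℕ-β₀ sC sz ss))) (tNR 0)
      Q (suc m) = Red-≐ dC (ext σ (numeral (suc m)))
                      (proj₁ (Red-sub dC (stepTy-pt σ (numeral m) (NR m)) _) (fundamental ds (redEnv-ext (wfTm ds) (redEnv-ext (wf-init (wfTm ds)) g (Red-numeral σ m)) (Q m))))
                      (tm-sym (castTmEq3 refl (lift2-ext σ (numeral m) (NR m) s) (lift-ext σ (su (numeral m)) C) (ℕ-β₁ sC sz ss (numeral-ℕ m))))
                      (tNR (suc m))
      CE = cong-subTy dC (eext (erefl (wf-init (wfTy dC)) S) (numeral-ℕ k) tn (tm-sym neq) (ty-refl (ℕ-F ε-wf)))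
      RCk = Red-≐env dC CE (Q k)
      eqk = tm-conv (castTmEq (lift-ext σ (numeral k) C) (natrec-cong (ty-refl sC) (tm-refl sz) (tm-refl ss) (tm-sym neq))) CE
      typing = castTm (sub-single σ n C) (subTm (ℕ-E dC dz ds dn) S)
  fundamental {σ = σ} (cell-I n α w) g = Red-cell σ n α

  canonicity-G : ∀ {τ} → ε ⊢ τ ∶ `G → Σ[ a ∈ Cell 0 ] (ε ⊢ τ ≐ cell 0 a ∶ `G)
  canonicity-G {τ} d = subst (λ t → Σ[ a ∈ Cell 0 ] (ε ⊢ t ≐ cell 0 a ∶ `G)) (sub-var τ) (proj₂ (fundamental d redEnv-ε))

corollary4p6 : (G : RGS) → let open Syntax G in
    (τ : Tm) → ε ⊢ τ ∶ `G →
    Σ[ a ∈ Cell 0 ] Σ[ p ∈ Tm ] (ε ⊢ p ∶ `Id `G τ (cell 0 a))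
corollary4p6 G τ dτ =
  let open Metatheory G
      a , τ≐a = canonicity-G dτ
  in a , rf `G τ , rf-≐ τ≐a
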